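{- Let $n\ge 4$ and $k>0$ be integers. Let $\tilde R$ be a quiver on the vertex set $[1,n-1]$ such that $b_{ij}(\tilde R)\ge 2$ whenever $i<j$. Define a quiver $Q$ on the vertex set $[1,n]$ by requiring that its full subquiver on $[1,n-1]$ equals the quiver obtained from $\tilde R$ by mutating successively at $2,1,2,1,\dots,2,1$ ($2k$ mutations, starting with $2$), and choosing the values $b_{in}(Q)\ge 2$ ($1\le i\le n-1$) arbitrarily (so $n$ is a sink of $Q$). Then $Q$ lies on a mutation cycle of length $n+4k$: applying to $Q$ the mutations at the vertices $$n,\ 1,2,1,2,\dots,1,2\ (2k\text{ mutations}),\ n-1,\ n-2,\ \dots,\ 2,\ 1,\ 2,1,2,1,\dots,2,1\ (2k\text{ mutations})$$ in this order returns $Q$.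
   Context: A quiver on the vertex set $[1,n]$ is a finite directed multigraph with no loops and no oriented 2-cycles; quivers are labeled. A quiver $Q$ is encoded by the skew-symmetric integer matrix $B(Q)=(b_{ij})$, where $b_{ij}>0$ means there are $b_{ij}$ arrows from $i$ to $j$. The full subquiver on a vertex subset $S$ is the induced subgraph on $S$. Mutation at a vertex $k$ produces the quiver $\mu[k](Q)$ with matrix $b'_{ij}=-b_{ij}$ if $k\in\{i,j\}$ and $b'_{ij}=b_{ij}+\tfrac12(|b_{ik}|b_{kj}+b_{ik}|b_{kj}|)$ otherwise. A vertex $n$ is a sink if $b_{in}\ge 0$ for all $i$. A mutation cycle of length $N$ based at $Q$ is a sequence $i_1,\dots,i_N$ of vertices with consecutive entries distinct (cyclically, including $i_N\ne i_1$), no mutation applied at an isolated vertex, such that mutating $Q$ successively at $i_1,\dots,i_N$ returns $Q$. -}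

module Defs where

open import Data.Nat as ℕ using (ℕ; zero; suc)
open import Data.Integer as ℤ using (ℤ; +_; -_; _/ℕ_)
open import Data.Fin using (Fin; zero; suc; inject₁; fromℕ; _≟_)
open import Data.List using (List; []; _∷_; _++_; concat; replicate; reverse; map)
open import Data.List.Base using (allFin)
open import Data.Product using (_×_)
open import Data.Unit using (⊤)
open import Data.Empty using (⊥)
open import Data.Bool using (if_then_else_; _∨_)
open import Relation.Nullary using (¬_; does)
open import Relation.Binary.PropositionalEquality using (_≡_; _≢_)

-- An exchange matrix on the vertex set Fin n (vertex i+1 of [1,n] is the
-- element i of Fin n).
Matrix : ℕ → Set
Matrix n = Fin n → Fin n → ℤ

-- A quiver (no loops, no oriented 2-cycles) is encoded by a
-- skew-symmetric integer matrix.
IsQuiver : {n : ℕ} → Matrix n → Set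
IsQuiver {n} B = ∀ (i j : Fin n) → B i j ≡ - B j i

absℤ : ℤ → ℤ
absℤ x = + ℤ.∣ x ∣

mutate : {n : ℕ} → Fin n → Matrix n → Matrix n
mutate k B i j =
  if does (i ≟ k) ∨ does (j ≟ k)
  then - B i j
  else B i j ℤ.+ ((absℤ (B i k) ℤ.* B k j ℤ.+ B i k ℤ.* absℤ (B k j)) /ℕ 2)

mutateSeq : {n : ℕ} → List (Fin n) → Matrix n → Matrix n
mutateSeq []       B = B
mutateSeq (k ∷ ks) B = mutateSeq ks (mutate k B)

Isolated : {n : ℕ} → Matrix n → Fin n → Set
Isolated {n} B k = ∀ (i : Fin n) → B i k ≡ + 0

NonIsolatedSteps : {n : ℕ} → Matrix n → List (Fin n) → Set
NonIsolatedSteps B []       = ⊤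
NonIsolatedSteps B (k ∷ ks) = (¬ Isolated B k) × NonIsolatedSteps (mutate k B) ks

ConsecDistinct : {n : ℕ} → List (Fin n) → Set
ConsecDistinct []           = ⊤
ConsecDistinct (x ∷ [])     = ⊤
ConsecDistinct (x ∷ y ∷ xs) = (x ≢ y) × ConsecDistinct (y ∷ xs)

CyclicallyDistinct : {n : ℕ} → List (Fin n) → Set
CyclicallyDistinct []       = ⊥
CyclicallyDistinct (x ∷ xs) = ConsecDistinct (x ∷ xs ++ x ∷ [])

record MutationCycle {n : ℕ} (B : Matrix n) (seq : List (Fin n)) : Set where
  field
    cyclicallyDistinct : CyclicallyDistinct seq
    nonIsolated        : NonIsolatedSteps B seq
    returns            : ∀ (i j : Fin n) → mutateSeq seq B i j ≡ B i j

v1 : {p : ℕ} → Fin (2 ℕ.+ p)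
v1 = zero

v2 : {p : ℕ} → Fin (2 ℕ.+ p)
v2 = suc zero

alt21 : {p : ℕ} → ℕ → List (Fin (2 ℕ.+ p))
alt21 k = concat (replicate k (v2 ∷ v1 ∷ []))

alt12 : {p : ℕ} → ℕ → List (Fin (2 ℕ.+ p))
alt12 k = concat (replicate k (v1 ∷ v2 ∷ []))

-- m, m-1, …, 1 viewed in [1, m+1]
descending : (m : ℕ) → List (Fin (suc m))
descending m = map inject₁ (reverse (allFin m))

-- The full mutation sequence on [1,n], n = 4 + p:
-- n, (1,2)^k, n-1, n-2, …, 1, (2,1)^k
cycleSeq : (p k : ℕ) → List (Fin (4 ℕ.+ p))
cycleSeq p k = fromℕ (3 ℕ.+ p) ∷ (alt12 k ++ (descending (3 ℕ.+ p) ++ alt21 k))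

-- Let a = b₁₂ ≥ 2. Since n is a sink of Q, the first mutation only reverses the arrows at n,
-- and the block (1,2)ᵏ then undoes the (2,1)ᵏ that produced Q from R̃ on [1,n−1]. The
-- vertices n−1, …, 3 are therefore sinks in turn and mutating at them only reverses arrows.
-- What remains is to see that the following μ₁ ∘ μ₂ yields μ_{(1,2)ᵏ}(Q), which the final
-- (2,1)ᵏ takes back to Q. Mutations at 1 and 2 act linearly on the columns (b₁ₓ, b₂ₓ) as
-- long as suitable sign conditions hold; these are kept by two invariant cones (this is
-- where a ≥ 2 enters), and the entries bₓₙ are matched through a bilinear form that the
-- column maps preserve.
module Submission where

open import Data.Bool using (Bool; true; false; _∧_)
import Data.Bool.Properties as Boolₚ
open import Data.Fin as Fin using (Fin; zero; suc; inject₁; fromℕ; toℕ; _≟_)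
import Data.Fin.Properties as Finₚ
open import Data.Fin.Relation.Unary.Top using (View; view; ‵fromℕ; ‵inject₁)
open import Data.Integer as ℤ using (ℤ; +_; -[1+_]; -_; 0ℤ; _+_; _*_; _-_; _≤_; _/ℕ_; +≤+)
import Data.Integer.Properties as ℤₚ
open import Data.Integer.Tactic.RingSolver using (solve-∀)
open import Data.List using (List; []; _∷_; _++_; concat; replicate; reverse; map; tabulate)
import Data.List.Properties as Listₚ
open import Data.List.Relation.Unary.Linked using (Linked; []; [-]; _∷_)
open import Data.Nat as ℕ using (ℕ; zero; suc; z≤n; s≤s)
import Data.Nat.DivMod as ℕ
import Data.Nat.Properties as ℕₚ
open import Data.Nat.GeneralisedArithmetic using (iterate)
open import Data.Product using (Σ; _×_; _,_; proj₁; proj₂)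
open import Data.Sum using (inj₁; inj₂)
open import Data.Unit using (⊤; tt)
open import Function using (_∘_)
open import Relation.Binary using (tri<; tri≈; tri>)
open import Relation.Binary.PropositionalEquality
open import Relation.Nullary using (¬_; Dec; yes; no; does; contradiction)
open import Relation.Nullary.Decidable using (dec-true; dec-false)
open import Defs

open ≡-Reasoning

mutationTerm : ℤ → ℤ → ℤ
mutationTerm x y = (absℤ x * y + x * absℤ y) /ℕ 2

private
  double : ∀ n → n ℕ.+ n ≡ n ℕ.* 2
  double n = trans (cong (n ℕ.+_) (sym (ℕₚ.+-identityʳ n))) (ℕₚ.*-comm 2 n)

  double-suc : ∀ n → suc (suc (n ℕ.+ n)) ≡ suc n ℕ.* 2
  double-suc n = trans (cong suc (sym (ℕₚ.+-suc n n))) (double (suc n))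

-- _/ℕ_ rounds towards −∞, so halving is only exact on even numerators.
half-double : ∀ z → (z + z) /ℕ 2 ≡ z
half-double (+ n) = cong +_ (trans (cong (ℕ._/ 2) (double n)) (ℕ.m*n/n≡m n 2))
half-double -[1+ n ] rewrite trans (cong (ℕ._% 2) (double-suc n)) (ℕ.m*n%n≡0 (suc n) 2) =
  cong (λ m → - (+ m)) (trans (cong (ℕ._/ 2) (double-suc n)) (ℕ.m*n/n≡m (suc n) 2))

private
  abs-nonNeg : ∀ {x} → 0ℤ ≤ x → absℤ x ≡ x
  abs-nonNeg = ℤₚ.0≤i⇒+∣i∣≡i

  abs-nonPos : ∀ {x} → x ≤ 0ℤ → absℤ x ≡ - x
  abs-nonPos {x} x≤0 = trans (cong +_ (sym (ℤₚ.∣-i∣≡∣i∣ x))) (abs-nonNeg (ℤₚ.neg-mono-≤ x≤0))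

  twice-neg : ∀ x y → (- x) * y + x * (- y) ≡ - (x * y) + - (x * y)
  twice-neg = solve-∀

  cancel-neg : ∀ x y → x * y + x * (- y) ≡ 0ℤ
  cancel-neg = solve-∀

  cancel-neg′ : ∀ x y → (- x) * y + x * y ≡ 0ℤ
  cancel-neg′ = solve-∀

  neg-*-neg : ∀ x y → (- x) * (- y) ≡ x * y
  neg-*-neg = solve-∀

  plus-zero : ∀ {x t} → t ≡ 0ℤ → x + t ≡ x
  plus-zero {x} refl = ℤₚ.+-identityʳ x

  neg-neg : ∀ {x y z} → x ≡ - y → y ≡ - z → x ≡ z
  neg-neg {z = z} x≡-y y≡-z = trans x≡-y (trans (cong -_ y≡-z) (ℤₚ.neg-involutive z))

mutationTerm-nonNeg : ∀ {x y} → 0ℤ ≤ x → 0ℤ ≤ y → mutationTerm x y ≡ x * y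
mutationTerm-nonNeg {x} {y} 0≤x 0≤y = begin
  (absℤ x * y + x * absℤ y) /ℕ 2 ≡⟨ cong₂ (λ u v → (u * y + x * v) /ℕ 2) (abs-nonNeg 0≤x) (abs-nonNeg 0≤y) ⟩
  (x * y + x * y) /ℕ 2           ≡⟨ half-double (x * y) ⟩
  x * y                          ∎

mutationTerm-nonPos : ∀ {x y} → x ≤ 0ℤ → y ≤ 0ℤ → mutationTerm x y ≡ - (x * y)
mutationTerm-nonPos {x} {y} x≤0 y≤0 = begin
  (absℤ x * y + x * absℤ y) /ℕ 2     ≡⟨ cong₂ (λ u v → (u * y + x * v) /ℕ 2) (abs-nonPos x≤0) (abs-nonPos y≤0) ⟩
  ((- x) * y + x * (- y)) /ℕ 2       ≡⟨ cong (_/ℕ 2) (twice-neg x y) ⟩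
  (- (x * y) + - (x * y)) /ℕ 2       ≡⟨ half-double (- (x * y)) ⟩
  - (x * y)                          ∎

mutationTerm-nonNeg-nonPos : ∀ {x y} → 0ℤ ≤ x → y ≤ 0ℤ → mutationTerm x y ≡ 0ℤ
mutationTerm-nonNeg-nonPos {x} {y} 0≤x y≤0 = begin
  (absℤ x * y + x * absℤ y) /ℕ 2 ≡⟨ cong₂ (λ u v → (u * y + x * v) /ℕ 2) (abs-nonNeg 0≤x) (abs-nonPos y≤0) ⟩
  (x * y + x * (- y)) /ℕ 2       ≡⟨ cong (_/ℕ 2) (cancel-neg x y) ⟩
  0ℤ                             ∎

mutationTerm-nonPos-nonNeg : ∀ {x y} → x ≤ 0ℤ → 0ℤ ≤ y → mutationTerm x y ≡ 0ℤ
mutationTerm-nonPos-nonNeg {x} {y} x≤0 0≤y = begin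
  (absℤ x * y + x * absℤ y) /ℕ 2 ≡⟨ cong₂ (λ u v → (u * y + x * v) /ℕ 2) (abs-nonPos x≤0) (abs-nonNeg 0≤y) ⟩
  ((- x) * y + x * y) /ℕ 2       ≡⟨ cong (_/ℕ 2) (cancel-neg′ x y) ⟩
  0ℤ                             ∎

mutationTerm-comm : ∀ x y → mutationTerm x y ≡ mutationTerm y x
mutationTerm-comm x y = cong (_/ℕ 2) (swap (absℤ x) (absℤ y) x y)
  where
  swap : ∀ u v x y → u * y + x * v ≡ v * x + y * u
  swap = solve-∀

mutationTerm-neg : ∀ x y → mutationTerm (- x) (- y) ≡ - mutationTerm x y
mutationTerm-neg x y with ℤₚ.≤-total x 0ℤ | ℤₚ.≤-total y 0ℤ
... | inj₁ x≤0 | inj₁ y≤0 = begin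
  mutationTerm (- x) (- y) ≡⟨ mutationTerm-nonNeg (ℤₚ.neg-mono-≤ x≤0) (ℤₚ.neg-mono-≤ y≤0) ⟩
  (- x) * (- y)            ≡⟨ neg-*-neg x y ⟩
  x * y                    ≡⟨ ℤₚ.neg-involutive (x * y) ⟨
  - - (x * y)              ≡⟨ cong -_ (mutationTerm-nonPos x≤0 y≤0) ⟨
  - mutationTerm x y       ∎
... | inj₁ x≤0 | inj₂ 0≤y = trans (mutationTerm-nonNeg-nonPos (ℤₚ.neg-mono-≤ x≤0) (ℤₚ.neg-mono-≤ 0≤y))
                                  (cong -_ (sym (mutationTerm-nonPos-nonNeg x≤0 0≤y)))
... | inj₂ 0≤x | inj₁ y≤0 = trans (mutationTerm-nonPos-nonNeg (ℤₚ.neg-mono-≤ 0≤x) (ℤₚ.neg-mono-≤ y≤0))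
                                  (cong -_ (sym (mutationTerm-nonNeg-nonPos 0≤x y≤0)))
... | inj₂ 0≤x | inj₂ 0≤y = begin
  mutationTerm (- x) (- y) ≡⟨ mutationTerm-nonPos (ℤₚ.neg-mono-≤ 0≤x) (ℤₚ.neg-mono-≤ 0≤y) ⟩
  - ((- x) * (- y))        ≡⟨ cong -_ (neg-*-neg x y) ⟩
  - (x * y)                ≡⟨ cong -_ (mutationTerm-nonNeg 0≤x 0≤y) ⟨
  - mutationTerm x y       ∎

infix 4 _≐_

_≐_ : ∀ {n} → Matrix n → Matrix n → Set
A ≐ B = ∀ i j → A i j ≡ B i j

module _ {n : ℕ} where

  mutate-pivotRow : ∀ k (B : Matrix n) j → mutate k B k j ≡ - B k j
  mutate-pivotRow k B j with k ≟ k
  ... | yes _  = refl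
  ... | no k≢k = contradiction refl k≢k

  mutate-pivotCol : ∀ k (B : Matrix n) i → mutate k B i k ≡ - B i k
  mutate-pivotCol k B i with i ≟ k
  ... | yes _ = refl
  ... | no _ with k ≟ k
  ...   | yes _  = refl
  ...   | no k≢k = contradiction refl k≢k

  mutate-offPivot : ∀ k (B : Matrix n) {i j} → i ≢ k → j ≢ k →
                    mutate k B i j ≡ B i j + mutationTerm (B i k) (B k j)
  mutate-offPivot k B {i} {j} i≢k j≢k with i ≟ k
  ... | yes i≡k = contradiction i≡k i≢k
  ... | no _ with j ≟ k
  ...   | yes j≡k = contradiction j≡k j≢k
  ...   | no _    = refl

  mutate-cong : ∀ k {A B : Matrix n} → A ≐ B → mutate k A ≐ mutate k B
  mutate-cong k {A} {B} A≐B i j with i ≟ k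
  ... | yes _ = cong -_ (A≐B i j)
  ... | no _ with j ≟ k
  ...   | yes _ = cong -_ (A≐B i j)
  ...   | no _  = cong₂ (λ b c → b + c) (A≐B i j) (cong₂ mutationTerm (A≐B i k) (A≐B k j))

  mutateSeq-cong : ∀ ks {A B : Matrix n} → A ≐ B → mutateSeq ks A ≐ mutateSeq ks B
  mutateSeq-cong []       A≐B = A≐B
  mutateSeq-cong (k ∷ ks) A≐B = mutateSeq-cong ks (mutate-cong k A≐B)

  mutateSeq-++ : ∀ ks ls (B : Matrix n) → mutateSeq (ks ++ ls) B ≡ mutateSeq ls (mutateSeq ks B)
  mutateSeq-++ []       ls B = refl
  mutateSeq-++ (k ∷ ks) ls B = mutateSeq-++ ks ls (mutate k B)

  isQuiver-diagonal : ∀ {B : Matrix n} → IsQuiver B → ∀ i → B i i ≡ 0ℤ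
  isQuiver-diagonal {B} B-quiver i = self-neg (B i i) (B-quiver i i)
    where
    self-neg : ∀ x → x ≡ - x → x ≡ 0ℤ
    self-neg (+ zero)  _  = refl
    self-neg (+ suc _) ()
    self-neg -[1+ _ ]  ()

  mutate-isQuiver : ∀ k {B : Matrix n} → IsQuiver B → IsQuiver (mutate k B)
  mutate-isQuiver k {B} B-quiver i j = by-cases (i ≟ k) (j ≟ k)
    where
    by-cases : Dec (i ≡ k) → Dec (j ≡ k) → mutate k B i j ≡ - mutate k B j i
    by-cases (yes refl) _ = begin
      mutate k B k j  ≡⟨ mutate-pivotRow k B j ⟩
      - B k j         ≡⟨ cong -_ (B-quiver k j) ⟩
      - - B j k       ≡⟨ cong -_ (mutate-pivotCol k B j) ⟨
      - mutate k B j k ∎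
    by-cases (no _) (yes refl) = begin
      mutate k B i k  ≡⟨ mutate-pivotCol k B i ⟩
      - B i k         ≡⟨ cong -_ (B-quiver i k) ⟩
      - - B k i       ≡⟨ cong -_ (mutate-pivotRow k B i) ⟨
      - mutate k B k i ∎
    by-cases (no i≢k) (no j≢k) = begin
      mutate k B i j                                   ≡⟨ mutate-offPivot k B i≢k j≢k ⟩
      B i j + mutationTerm (B i k) (B k j)             ≡⟨ cong₂ _+_ (B-quiver i j) (mutationTerm-comm (B i k) (B k j)) ⟩
      - B j i + mutationTerm (B k j) (B i k)
        ≡⟨ cong (λ t → - B j i + t) (cong₂ mutationTerm (B-quiver k j) (B-quiver i k)) ⟩
      - B j i + mutationTerm (- B j k) (- B k i)       ≡⟨ cong (λ t → - B j i + t) (mutationTerm-neg (B j k) (B k i)) ⟩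
      - B j i + - mutationTerm (B j k) (B k i)         ≡⟨ ℤₚ.neg-distrib-+ (B j i) _ ⟨
      - (B j i + mutationTerm (B j k) (B k i))         ≡⟨ cong -_ (mutate-offPivot k B j≢k i≢k) ⟨
      - mutate k B j i                                 ∎

  mutateSeq-isQuiver : ∀ ks {B : Matrix n} → IsQuiver B → IsQuiver (mutateSeq ks B)
  mutateSeq-isQuiver []       B-quiver = B-quiver
  mutateSeq-isQuiver (k ∷ ks) B-quiver = mutateSeq-isQuiver ks (mutate-isQuiver k B-quiver)

  mutate-involutive : ∀ k (B : Matrix n) → mutate k (mutate k B) ≐ B
  mutate-involutive k B i j = by-cases (i ≟ k) (j ≟ k)
    where
    t = mutationTerm (B i k) (B k j)
    cancel : ∀ b t → (b + t) + - t ≡ b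
    cancel = solve-∀
    by-cases : Dec (i ≡ k) → Dec (j ≡ k) → mutate k (mutate k B) i j ≡ B i j
    by-cases (yes refl) _      = neg-neg (mutate-pivotRow k (mutate k B) j) (mutate-pivotRow k B j)
    by-cases (no _) (yes refl) = neg-neg (mutate-pivotCol k (mutate k B) i) (mutate-pivotCol k B i)
    by-cases (no i≢k) (no j≢k) = begin
      mutate k (mutate k B) i j
        ≡⟨ mutate-offPivot k (mutate k B) i≢k j≢k ⟩
      mutate k B i j + mutationTerm (mutate k B i k) (mutate k B k j)
        ≡⟨ cong₂ (λ b c → b + mutationTerm c (mutate k B k j)) (mutate-offPivot k B i≢k j≢k) (mutate-pivotCol k B i) ⟩
      (B i j + t) + mutationTerm (- B i k) (mutate k B k j)
        ≡⟨ cong (λ c → (B i j + t) + mutationTerm (- B i k) c) (mutate-pivotRow k B j) ⟩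
      (B i j + t) + mutationTerm (- B i k) (- B k j)
        ≡⟨ cong (λ c → (B i j + t) + c) (mutationTerm-neg (B i k) (B k j)) ⟩
      (B i j + t) + - t
        ≡⟨ cancel (B i j) t ⟩
      B i j ∎

  mutateSeq-reverse : ∀ ks (B : Matrix n) → mutateSeq (reverse ks) (mutateSeq ks B) ≐ B
  mutateSeq-reverse []       B = λ _ _ → refl
  mutateSeq-reverse (k ∷ ks) B i j = begin
    mutateSeq (reverse (k ∷ ks)) (mutateSeq ks (mutate k B)) i j
      ≡⟨ cong (λ C → C i j) (cong (λ ls → mutateSeq ls (mutateSeq ks (mutate k B))) (Listₚ.unfold-reverse k ks)) ⟩
    mutateSeq (reverse ks ++ k ∷ []) (mutateSeq ks (mutate k B)) i j
      ≡⟨ cong (λ C → C i j) (mutateSeq-++ (reverse ks) (k ∷ []) _) ⟩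
    mutate k (mutateSeq (reverse ks) (mutateSeq ks (mutate k B))) i j
      ≡⟨ mutate-cong k (mutateSeq-reverse ks (mutate k B)) i j ⟩
    mutate k (mutate k B) i j
      ≡⟨ mutate-involutive k B i j ⟩
    B i j ∎

  mutate-atSink : ∀ k {B : Matrix n} → IsQuiver B → (∀ i → 0ℤ ≤ B i k) →
                  ∀ {i j} → i ≢ k → j ≢ k → mutate k B i j ≡ B i j
  mutate-atSink k {B} B-quiver sink {i} {j} i≢k j≢k = begin
    mutate k B i j                       ≡⟨ mutate-offPivot k B i≢k j≢k ⟩
    B i j + mutationTerm (B i k) (B k j) ≡⟨ cong (λ c → B i j + c) (mutationTerm-nonNeg-nonPos (sink i) Bkj≤0) ⟩
    B i j + 0ℤ                           ≡⟨ ℤₚ.+-identityʳ (B i j) ⟩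
    B i j                                ∎
    where
    Bkj≤0 : B k j ≤ 0ℤ
    Bkj≤0 = subst (_≤ 0ℤ) (sym (B-quiver k j)) (ℤₚ.neg-mono-≤ (sink j))

  nonIsolatedSteps-++ : ∀ {B : Matrix n} ks ls → NonIsolatedSteps B ks →
                        NonIsolatedSteps (mutateSeq ks B) ls → NonIsolatedSteps B (ks ++ ls)
  nonIsolatedSteps-++ []       ls _              steps = steps
  nonIsolatedSteps-++ (k ∷ ks) ls (k-ok , ks-ok) steps = k-ok , nonIsolatedSteps-++ ks ls ks-ok steps

  nonIsolatedSteps-cong : ∀ {A B : Matrix n} ks → A ≐ B → NonIsolatedSteps A ks → NonIsolatedSteps B ks
  nonIsolatedSteps-cong []       A≐B _              = tt
  nonIsolatedSteps-cong (k ∷ ks) A≐B (k-ok , ks-ok) =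
    (λ isolated → k-ok (λ i → trans (A≐B i k) (isolated i))) ,
    nonIsolatedSteps-cong ks (mutate-cong k A≐B) ks-ok

  alternating-nonIsolated : ∀ {u w} j (B : Matrix n) → B u w ≢ 0ℤ → B w u ≢ 0ℤ →
                            NonIsolatedSteps B (concat (replicate j (u ∷ w ∷ [])))
  alternating-nonIsolated zero    _ _     _     = tt
  alternating-nonIsolated {u} {w} (suc j) B Buw≢0 Bwu≢0 =
    (λ isolated → Bwu≢0 (isolated w)) ,
    (λ isolated → B′uw≢0 (isolated u)) ,
    alternating-nonIsolated j (mutate w B′)
      (subst (_≢ 0ℤ) (sym (mutate-pivotCol w B′ u)) (neg≢0 B′uw≢0))
      (subst (_≢ 0ℤ) (sym (mutate-pivotRow w B′ u)) (neg≢0 B′wu≢0))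
    where
    neg≢0 : ∀ {x} → x ≢ 0ℤ → - x ≢ 0ℤ
    neg≢0 {x} x≢0 -x≡0 = x≢0 (trans (sym (ℤₚ.neg-involutive x)) (cong -_ -x≡0))
    B′ = mutate u B
    B′uw≢0 : B′ u w ≢ 0ℤ
    B′uw≢0 = subst (_≢ 0ℤ) (sym (mutate-pivotRow u B w)) (neg≢0 Buw≢0)
    B′wu≢0 : B′ w u ≢ 0ℤ
    B′wu≢0 = subst (_≢ 0ℤ) (sym (mutate-pivotCol u B w)) (neg≢0 Bwu≢0)

-- Sign conjugation and mutation at sinks

signed : Bool → ℤ → ℤ
signed false x = x
signed true  x = - x

signed-zero : ∀ b → signed b 0ℤ ≡ 0ℤ
signed-zero false = refl
signed-zero true  = refl

signed-neg : ∀ b x → signed b (- x) ≡ - signed b x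
signed-neg false x = refl
signed-neg true  x = refl

signed-comm : ∀ b c x → signed b (signed c x) ≡ signed c (signed b x)
signed-comm false c     x = refl
signed-comm true  false x = refl
signed-comm true  true  x = refl

conjugate : ∀ {n} → (Fin n → Bool) → Matrix n → Matrix n
conjugate s B i j = signed (s i) (signed (s j) (B i j))

module _ {n : ℕ} where

  conjugate-isQuiver : ∀ s {B : Matrix n} → IsQuiver B → IsQuiver (conjugate s B)
  conjugate-isQuiver s {B} B-quiver i j = begin
    signed (s i) (signed (s j) (B i j))     ≡⟨ cong (signed (s i) ∘ signed (s j)) (B-quiver i j) ⟩
    signed (s i) (signed (s j) (- B j i))   ≡⟨ cong (signed (s i)) (signed-neg (s j) (B j i)) ⟩
    signed (s i) (- signed (s j) (B j i))   ≡⟨ signed-neg (s i) _ ⟩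
    - signed (s i) (signed (s j) (B j i))   ≡⟨ cong -_ (signed-comm (s i) (s j) (B j i)) ⟩
    - signed (s j) (signed (s i) (B j i))   ∎

  -- Mutation at a sink k reverses its arrows, i.e. adds k to the conjugating set.
  mutate-atSink-conjugate : ∀ k {s s′ : Fin n → Bool} {B : Matrix n} → IsQuiver B →
    (∀ i → 0ℤ ≤ conjugate s B i k) → s k ≡ false → s′ k ≡ true → (∀ i → i ≢ k → s′ i ≡ s i) →
    mutate k (conjugate s B) ≐ conjugate s′ B
  mutate-atSink-conjugate k {s} {s′} {B} B-quiver sink sk s′k s′≡s i j = by-cases (i ≟ k) (j ≟ k)
    where
    C = conjugate s B
    C-quiver = conjugate-isQuiver s B-quiver
    by-cases : Dec (i ≡ k) → Dec (j ≡ k) → mutate k C i j ≡ conjugate s′ B i j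
    by-cases (yes refl) (yes refl) =
      trans (isQuiver-diagonal (mutate-isQuiver k C-quiver) k)
            (sym (isQuiver-diagonal (conjugate-isQuiver s′ B-quiver) k))
    by-cases (yes refl) (no j≢k) = begin
      mutate k C k j                         ≡⟨ mutate-pivotRow k C j ⟩
      - signed (s k) (signed (s j) (B k j))  ≡⟨ cong (λ b → - signed b (signed (s j) (B k j))) sk ⟩
      - signed (s j) (B k j)                 ≡⟨ cong (λ b → - signed b (B k j)) (s′≡s j j≢k) ⟨
      - signed (s′ j) (B k j)                ≡⟨ cong (λ b → signed b (signed (s′ j) (B k j))) s′k ⟨
      conjugate s′ B k j                     ∎
    by-cases (no i≢k) (yes refl) = begin
      mutate k C i k                         ≡⟨ mutate-pivotCol k C i ⟩
      - signed (s i) (signed (s k) (B i k))  ≡⟨ cong (λ b → - signed (s i) (signed b (B i k))) sk ⟩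
      - signed (s i) (B i k)                 ≡⟨ signed-neg (s i) (B i k) ⟨
      signed (s i) (- B i k)                 ≡⟨ cong (λ b → signed b (- B i k)) (s′≡s i i≢k) ⟨
      signed (s′ i) (- B i k)                ≡⟨ cong (λ b → signed (s′ i) (signed b (B i k))) s′k ⟨
      conjugate s′ B i k                     ∎
    by-cases (no i≢k) (no j≢k) = begin
      mutate k C i j                         ≡⟨ mutate-atSink k C-quiver sink i≢k j≢k ⟩
      signed (s i) (signed (s j) (B i j))    ≡⟨ cong₂ (λ b c → signed b (signed c (B i j))) (s′≡s i i≢k) (s′≡s j j≢k) ⟨
      conjugate s′ B i j                     ∎

restrict : ∀ {n} → Matrix (suc n) → Matrix n
restrict B i j = B (inject₁ i) (inject₁ j)

module _ {n : ℕ} where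

  restrict-mutate : ∀ k (B : Matrix (suc n)) → restrict (mutate (inject₁ k) B) ≐ mutate k (restrict B)
  restrict-mutate k B i j = by-cases (i ≟ k) (j ≟ k)
    where
    ι≢ : ∀ {l} → l ≢ k → inject₁ l ≢ inject₁ k
    ι≢ l≢k = l≢k ∘ Finₚ.inject₁-injective
    by-cases : Dec (i ≡ k) → Dec (j ≡ k) → mutate (inject₁ k) B (inject₁ i) (inject₁ j) ≡ mutate k (restrict B) i j
    by-cases (yes refl) _ = trans (mutate-pivotRow (inject₁ k) B _) (sym (mutate-pivotRow k (restrict B) j))
    by-cases (no _) (yes refl) = trans (mutate-pivotCol (inject₁ k) B _) (sym (mutate-pivotCol k (restrict B) i))
    by-cases (no i≢k) (no j≢k) =
      trans (mutate-offPivot (inject₁ k) B (ι≢ i≢k) (ι≢ j≢k)) (sym (mutate-offPivot k (restrict B) i≢k j≢k))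

  restrict-mutateSeq : ∀ ks (B : Matrix (suc n)) → restrict (mutateSeq (map inject₁ ks) B) ≐ mutateSeq ks (restrict B)
  restrict-mutateSeq []       B = λ _ _ → refl
  restrict-mutateSeq (k ∷ ks) B i j =
    trans (restrict-mutateSeq ks (mutate (inject₁ k) B) i j) (mutateSeq-cong ks (restrict-mutate k B) i j)

concat-replicate-comm : ∀ {A : Set} j (xs : List A) → concat (replicate j xs) ++ xs ≡ xs ++ concat (replicate j xs)
concat-replicate-comm zero    xs = sym (Listₚ.++-identityʳ xs)
concat-replicate-comm (suc j) xs = begin
  (xs ++ concat (replicate j xs)) ++ xs ≡⟨ Listₚ.++-assoc xs _ xs ⟩
  xs ++ (concat (replicate j xs) ++ xs) ≡⟨ cong (xs ++_) (concat-replicate-comm j xs) ⟩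
  xs ++ (xs ++ concat (replicate j xs)) ∎

reverse-alternating : ∀ {A : Set} j (u w : A) →
  reverse (concat (replicate j (u ∷ w ∷ []))) ≡ concat (replicate j (w ∷ u ∷ []))
reverse-alternating zero    u w = refl
reverse-alternating (suc j) u w = begin
  reverse (u ∷ w ∷ concat (replicate j (u ∷ w ∷ [])))
    ≡⟨ Listₚ.reverse-++ (u ∷ w ∷ []) (concat (replicate j (u ∷ w ∷ []))) ⟩
  reverse (concat (replicate j (u ∷ w ∷ []))) ++ w ∷ u ∷ []
    ≡⟨ cong (_++ w ∷ u ∷ []) (reverse-alternating j u w) ⟩
  concat (replicate j (w ∷ u ∷ [])) ++ w ∷ u ∷ []
    ≡⟨ concat-replicate-comm j (w ∷ u ∷ []) ⟩
  w ∷ u ∷ concat (replicate j (w ∷ u ∷ [])) ∎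

map-inject₁-alt12 : ∀ {q} j → map inject₁ (alt12 {q} j) ≡ alt12 j
map-inject₁-alt12 zero    = refl
map-inject₁-alt12 (suc j) = cong (λ ks → v1 ∷ v2 ∷ ks) (map-inject₁-alt12 j)

module _ {q : ℕ} where

  alt12-undoes-alt21 : ∀ i (B : Matrix (2 ℕ.+ q)) → mutateSeq (alt12 i) (mutateSeq (alt21 i) B) ≐ B
  alt12-undoes-alt21 i B = subst (λ ks → mutateSeq ks (mutateSeq (alt21 i) B) ≐ B)
                                 (reverse-alternating i v2 v1) (mutateSeq-reverse (alt21 i) B)

  alt21-undoes-alt12 : ∀ i (B : Matrix (2 ℕ.+ q)) → mutateSeq (alt21 i) (mutateSeq (alt12 i) B) ≐ B
  alt21-undoes-alt12 i B = subst (λ ks → mutateSeq ks (mutateSeq (alt12 i) B) ≐ B)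
                                 (reverse-alternating i v1 v2) (mutateSeq-reverse (alt12 i) B)

  restrict-alt12 : ∀ i (B : Matrix (3 ℕ.+ q)) → restrict (mutateSeq (alt12 i) B) ≐ mutateSeq (alt12 i) (restrict B)
  restrict-alt12 i B = subst (λ ks → restrict (mutateSeq ks B) ≐ mutateSeq (alt12 i) (restrict B))
                             (map-inject₁-alt12 i) (restrict-mutateSeq (alt12 i) B)

linked⇒consecDistinct : ∀ {n} {xs : List (Fin n)} → Linked _≢_ xs → ConsecDistinct xs
linked⇒consecDistinct []            = tt
linked⇒consecDistinct [-]           = tt
linked⇒consecDistinct (x≢y ∷ rest) = x≢y , linked⇒consecDistinct rest

alternating-linked : ∀ {A : Set} j {x u w : A} {ys} → x ≢ u → u ≢ w → w ≢ u → Linked _≢_ (w ∷ ys) →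
                     Linked _≢_ (x ∷ concat (replicate (suc j) (u ∷ w ∷ [])) ++ ys)
alternating-linked zero    x≢u u≢w w≢u rest = x≢u ∷ u≢w ∷ rest
alternating-linked (suc j) x≢u u≢w w≢u rest = x≢u ∷ u≢w ∷ alternating-linked j w≢u u≢w w≢u rest

tabulate-∷ʳ : ∀ {A : Set} m (g : Fin (suc m) → A) → tabulate g ≡ tabulate (g ∘ inject₁) ++ g (fromℕ m) ∷ []
tabulate-∷ʳ zero    g = refl
tabulate-∷ʳ (suc m) g = cong (g zero ∷_) (tabulate-∷ʳ m (g ∘ suc))

reverse-tabulate : ∀ {A : Set} m (g : Fin (suc m) → A) →
                   reverse (tabulate g) ≡ g (fromℕ m) ∷ reverse (tabulate (g ∘ inject₁))
reverse-tabulate m g =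
  trans (cong reverse (tabulate-∷ʳ m g)) (Listₚ.reverse-++ (tabulate (g ∘ inject₁)) (g (fromℕ m) ∷ []))

descending-linked : ∀ {A : Set} m (g : Fin (suc m) → A) {x ys} → (∀ {i l} → g i ≡ g l → i ≡ l) →
                    x ≢ g (fromℕ m) → Linked _≢_ (g zero ∷ ys) → Linked _≢_ (x ∷ reverse (tabulate g) ++ ys)
descending-linked zero    g g-inj x≢ rest = x≢ ∷ rest
descending-linked (suc m) g g-inj x≢ rest rewrite reverse-tabulate (suc m) g =
  x≢ ∷ descending-linked m (g ∘ inject₁) (Finₚ.inject₁-injective ∘ g-inj)
         (Finₚ.fromℕ≢inject₁ ∘ g-inj) rest

-- Alternating mutation at the vertices 1 and 2

negatePair : ℤ × ℤ → ℤ × ℤ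
negatePair (x₁ , x₂) = - x₁ , - x₂

negatePair-involutive : ∀ x → negatePair (negatePair x) ≡ x
negatePair-involutive (x₁ , x₂) = cong₂ _,_ (ℤₚ.neg-involutive x₁) (ℤₚ.neg-involutive x₂)

NonNeg : ℤ × ℤ → Set
NonNeg (x₁ , x₂) = 0ℤ ≤ x₁ × 0ℤ ≤ x₂

NonPos : ℤ × ℤ → Set
NonPos (x₁ , x₂) = x₁ ≤ 0ℤ × x₂ ≤ 0ℤ

-- The effect of mutating at 1 then 2 (resp. 2 then 1) on the column (b₁ₓ, b₂ₓ) of a
-- third vertex x, when b₁₂ = a and the signs are those of Ready12 (resp. Ready21).
module _ (a : ℤ) where

  round12 : ℤ × ℤ → ℤ × ℤ
  round12 (x₁ , x₂) = - x₁ + a * (x₂ + a * x₁) , - (x₂ + a * x₁)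

  round21 : ℤ × ℤ → ℤ × ℤ
  round21 (x₁ , x₂) = - (x₁ + a * x₂) , - x₂ + a * (x₁ + a * x₂)

  Ready12 : ℤ × ℤ → Set
  Ready12 (x₁ , x₂) = x₁ ≤ 0ℤ × x₂ + a * x₁ ≤ 0ℤ

  Ready21 : ℤ × ℤ → Set
  Ready21 (x₁ , x₂) = 0ℤ ≤ x₂ × 0ℤ ≤ x₁ + a * x₂

  pairing : ℤ × ℤ → ℤ × ℤ → ℤ
  pairing (x₁ , x₂) (y₁ , y₂) = x₁ * y₁ + x₂ * y₂ + a * x₁ * y₂

module _ {m : ℕ} where

  mutate12 : Matrix (2 ℕ.+ m) → Matrix (2 ℕ.+ m)
  mutate12 M = mutate v2 (mutate v1 M)

  mutate21 : Matrix (2 ℕ.+ m) → Matrix (2 ℕ.+ m)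
  mutate21 M = mutate v1 (mutate v2 M)

  column : Matrix (2 ℕ.+ m) → Fin (2 ℕ.+ m) → ℤ × ℤ
  column M x = M v1 x , M v2 x

  record Pivots (a : ℤ) (M : Matrix (2 ℕ.+ m)) : Set where
    constructor pivots
    field
      pivot₁₂ : M v1 v2 ≡ a
      pivot₂₁ : M v2 v1 ≡ - a

private
  v1≢v2 : ∀ {m} → v1 {m} ≢ v2
  v1≢v2 ()

  v2≢v1 : ∀ {m} → v2 {m} ≢ v1
  v2≢v1 ()

  other≢v1 : ∀ {m} {z : Fin m} → Fin.suc (suc z) ≢ v1
  other≢v1 ()

  other≢v2 : ∀ {m} {z : Fin m} → Fin.suc (suc z) ≢ v2
  other≢v2 ()


module _ {m : ℕ} {a : ℤ} (0≤a : 0ℤ ≤ a) where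

  private
    -a≤0 : - a ≤ 0ℤ
    -a≤0 = ℤₚ.neg-mono-≤ 0≤a

    negPivot-nonPos : ∀ {x} → x ≤ 0ℤ → mutationTerm (- a) x ≡ a * x
    negPivot-nonPos {x} x≤0 = trans (mutationTerm-nonPos -a≤0 x≤0) (neg-product a x)
      where
      neg-product : ∀ a x → - ((- a) * x) ≡ a * x
      neg-product = solve-∀

  mutate12-pivots : ∀ {M : Matrix (2 ℕ.+ m)} → Pivots a M → Pivots a (mutate12 M)
  mutate12-pivots {M} (pivots M₁₂ M₂₁) = pivots
    (trans (neg-neg (mutate-pivotCol v2 (mutate v1 M) v1) (mutate-pivotRow v1 M v2)) M₁₂)
    (trans (neg-neg (mutate-pivotRow v2 (mutate v1 M) v1) (mutate-pivotCol v1 M v2)) M₂₁)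

  mutate21-pivots : ∀ {M : Matrix (2 ℕ.+ m)} → Pivots a M → Pivots a (mutate21 M)
  mutate21-pivots {M} (pivots M₁₂ M₂₁) = pivots
    (trans (neg-neg (mutate-pivotRow v1 (mutate v2 M) v2) (mutate-pivotCol v2 M v1)) M₁₂)
    (trans (neg-neg (mutate-pivotCol v1 (mutate v2 M) v2) (mutate-pivotRow v2 M v1)) M₂₁)

  mutate1-entry : ∀ (M : Matrix (2 ℕ.+ m)) {b} {z : Fin m} → M v2 v1 ≡ b →
                  mutate v1 M v2 (suc (suc z)) ≡ M v2 (suc (suc z)) + mutationTerm b (M v1 (suc (suc z)))
  mutate1-entry M {z = z} M₂₁ = trans (mutate-offPivot v1 M v2≢v1 other≢v1)
    (cong (λ b → M v2 (suc (suc z)) + mutationTerm b (M v1 (suc (suc z)))) M₂₁)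

  mutate2-entry : ∀ (M : Matrix (2 ℕ.+ m)) {b} {z : Fin m} → M v1 v2 ≡ b →
                  mutate v2 M v1 (suc (suc z)) ≡ M v1 (suc (suc z)) + mutationTerm b (M v2 (suc (suc z)))
  mutate2-entry M {z = z} M₁₂ = trans (mutate-offPivot v2 M v1≢v2 other≢v2)
    (cong (λ b → M v1 (suc (suc z)) + mutationTerm b (M v2 (suc (suc z)))) M₁₂)

  module _ (M : Matrix (2 ℕ.+ m)) (M-pivots : Pivots a M) {z : Fin m} where

    private
      x = Fin.suc (suc z)
      x₁ = M v1 x
      x₂ = M v2 x
      M₁₂ = Pivots.pivot₁₂ M-pivots
      M₂₁ = Pivots.pivot₂₁ M-pivots

    mutate1-v2-nonPos : x₁ ≤ 0ℤ → mutate v1 M v2 x ≡ x₂ + a * x₁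
    mutate1-v2-nonPos x₁≤0 = trans (mutate1-entry M M₂₁) (cong (λ t → x₂ + t) (negPivot-nonPos x₁≤0))

    mutate1-v2-nonNeg : 0ℤ ≤ x₁ → mutate v1 M v2 x ≡ x₂
    mutate1-v2-nonNeg 0≤x₁ = trans (mutate1-entry M M₂₁) (plus-zero (mutationTerm-nonPos-nonNeg -a≤0 0≤x₁))

    mutate2-v1-nonNeg : 0ℤ ≤ x₂ → mutate v2 M v1 x ≡ x₁ + a * x₂
    mutate2-v1-nonNeg 0≤x₂ = trans (mutate2-entry M M₁₂) (cong (λ t → x₁ + t) (mutationTerm-nonNeg 0≤a 0≤x₂))

    mutate2-v1-nonPos : x₂ ≤ 0ℤ → mutate v2 M v1 x ≡ x₁
    mutate2-v1-nonPos x₂≤0 = trans (mutate2-entry M M₁₂) (plus-zero (mutationTerm-nonNeg-nonPos 0≤a x₂≤0))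

    private
      N₁₂ : mutate v1 M v1 v2 ≡ - a
      N₁₂ = trans (mutate-pivotRow v1 M v2) (cong -_ M₁₂)

      N₂₁ : mutate v2 M v2 v1 ≡ a
      N₂₁ = trans (mutate-pivotRow v2 M v1) (trans (cong -_ M₂₁) (ℤₚ.neg-involutive a))

    mutate12-column : Ready12 a (column M x) → column (mutate12 M) x ≡ round12 a (column M x)
    mutate12-column (x₁≤0 , y≤0) = cong₂ _,_ entry1 entry2
      where
      N = mutate v1 M
      entry1 : mutate v2 N v1 x ≡ - x₁ + a * (x₂ + a * x₁)
      entry1 = begin
        mutate v2 N v1 x                        ≡⟨ mutate2-entry N N₁₂ ⟩
        N v1 x + mutationTerm (- a) (N v2 x)    ≡⟨ cong₂ (λ b c → b + mutationTerm (- a) c) (mutate-pivotRow v1 M x) (mutate1-v2-nonPos x₁≤0) ⟩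
        - x₁ + mutationTerm (- a) (x₂ + a * x₁) ≡⟨ cong (λ t → - x₁ + t) (negPivot-nonPos y≤0) ⟩
        - x₁ + a * (x₂ + a * x₁)                ∎
      entry2 : mutate v2 N v2 x ≡ - (x₂ + a * x₁)
      entry2 = trans (mutate-pivotRow v2 N x) (cong -_ (mutate1-v2-nonPos x₁≤0))

    mutate12-column-nonNeg : NonNeg (column M x) → column (mutate12 M) x ≡ negatePair (column M x)
    mutate12-column-nonNeg (0≤x₁ , 0≤x₂) = cong₂ _,_ entry1 entry2
      where
      N = mutate v1 M
      entry1 : mutate v2 N v1 x ≡ - x₁
      entry1 = begin
        mutate v2 N v1 x                     ≡⟨ mutate2-entry N N₁₂ ⟩
        N v1 x + mutationTerm (- a) (N v2 x) ≡⟨ cong₂ (λ b c → b + mutationTerm (- a) c) (mutate-pivotRow v1 M x) (mutate1-v2-nonNeg 0≤x₁) ⟩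
        - x₁ + mutationTerm (- a) x₂         ≡⟨ plus-zero (mutationTerm-nonPos-nonNeg -a≤0 0≤x₂) ⟩
        - x₁                                 ∎
      entry2 : mutate v2 N v2 x ≡ - x₂
      entry2 = trans (mutate-pivotRow v2 N x) (cong -_ (mutate1-v2-nonNeg 0≤x₁))

    mutate21-column : Ready21 a (column M x) → column (mutate21 M) x ≡ round21 a (column M x)
    mutate21-column (0≤x₂ , 0≤y) = cong₂ _,_ entry1 entry2
      where
      N = mutate v2 M
      entry1 : mutate v1 N v1 x ≡ - (x₁ + a * x₂)
      entry1 = trans (mutate-pivotRow v1 N x) (cong -_ (mutate2-v1-nonNeg 0≤x₂))
      entry2 : mutate v1 N v2 x ≡ - x₂ + a * (x₁ + a * x₂)
      entry2 = begin
        mutate v1 N v2 x                    ≡⟨ mutate1-entry N N₂₁ ⟩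
        N v2 x + mutationTerm a (N v1 x)    ≡⟨ cong₂ (λ b c → b + mutationTerm a c) (mutate-pivotRow v2 M x) (mutate2-v1-nonNeg 0≤x₂) ⟩
        - x₂ + mutationTerm a (x₁ + a * x₂) ≡⟨ cong (λ t → - x₂ + t) (mutationTerm-nonNeg 0≤a 0≤y) ⟩
        - x₂ + a * (x₁ + a * x₂)            ∎

    mutate21-column-nonPos : NonPos (column M x) → column (mutate21 M) x ≡ negatePair (column M x)
    mutate21-column-nonPos (x₁≤0 , x₂≤0) = cong₂ _,_ entry1 entry2
      where
      N = mutate v2 M
      entry1 : mutate v1 N v1 x ≡ - x₁
      entry1 = trans (mutate-pivotRow v1 N x) (cong -_ (mutate2-v1-nonPos x₂≤0))
      entry2 : mutate v1 N v2 x ≡ - x₂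
      entry2 = begin
        mutate v1 N v2 x                 ≡⟨ mutate1-entry N N₂₁ ⟩
        N v2 x + mutationTerm a (N v1 x) ≡⟨ cong₂ (λ b c → b + mutationTerm a c) (mutate-pivotRow v2 M x) (mutate2-v1-nonPos x₂≤0) ⟩
        - x₂ + mutationTerm a x₁         ≡⟨ plus-zero (mutationTerm-nonNeg-nonPos 0≤a x₁≤0) ⟩
        - x₂                             ∎

  module _ (M : Matrix (2 ℕ.+ m)) (M-quiver : IsQuiver M) (M-pivots : Pivots a M) {z w : Fin m} where

    private
      x = Fin.suc (suc z)
      t = Fin.suc (suc w)
      x₁ = M v1 x
      x₂ = M v2 x
      t₁ = M v1 t
      t₂ = M v2 t

      row-nonNeg : ∀ {B : Matrix (2 ℕ.+ m)} {i j} → IsQuiver B → B j i ≤ 0ℤ → 0ℤ ≤ B i j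
      row-nonNeg {B} {i} {j} B-quiver Bji≤0 = subst (0ℤ ≤_) (sym (B-quiver i j)) (ℤₚ.neg-mono-≤ Bji≤0)

      row-entry : ∀ {B : Matrix (2 ℕ.+ m)} {i j c} → IsQuiver B → B j i ≡ c → B i j ≡ - c
      row-entry {B} {i} {j} B-quiver Bji≡c = trans (B-quiver i j) (cong -_ Bji≡c)

    mutate12-fixes : Ready12 a (column M x) → Ready12 a (column M t) → mutate12 M x t ≡ M x t
    mutate12-fixes (x₁≤0 , y≤0) (t₁≤0 , s≤0) = begin
      mutate v2 N x t                        ≡⟨ mutate-offPivot v2 N other≢v2 other≢v2 ⟩
      N x t + mutationTerm (N x v2) (N v2 t) ≡⟨ plus-zero (mutationTerm-nonNeg-nonPos 0≤Nₓ₂ Nₜ₂≤0) ⟩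
      N x t                                  ≡⟨ mutate-offPivot v1 M other≢v1 other≢v1 ⟩
      M x t + mutationTerm (M x v1) t₁       ≡⟨ plus-zero (mutationTerm-nonNeg-nonPos (row-nonNeg {B = M} {x} {v1} M-quiver x₁≤0) t₁≤0) ⟩
      M x t                                  ∎
      where
      N = mutate v1 M
      0≤Nₓ₂ : 0ℤ ≤ N x v2
      0≤Nₓ₂ = row-nonNeg {B = N} {x} {v2} (mutate-isQuiver v1 M-quiver) (subst (_≤ 0ℤ) (sym (mutate1-v2-nonPos M M-pivots x₁≤0)) y≤0)
      Nₜ₂≤0 : N v2 t ≤ 0ℤ
      Nₜ₂≤0 = subst (_≤ 0ℤ) (sym (mutate1-v2-nonPos M M-pivots {w} t₁≤0)) s≤0

    mutate12-pairing : Ready12 a (column M x) → NonNeg (column M t) →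
                       mutate12 M x t ≡ M x t - pairing a (column M x) (column M t)
    mutate12-pairing (x₁≤0 , y≤0) (0≤t₁ , 0≤t₂) = begin
      mutate v2 N x t                                    ≡⟨ mutate-offPivot v2 N other≢v2 other≢v2 ⟩
      N x t + mutationTerm (N x v2) (N v2 t)             ≡⟨ cong₂ (λ b c → b + mutationTerm c (N v2 t)) Nₓₜ Nₓ₂ ⟩
      (M x t + - x₁ * t₁) + mutationTerm (- (x₂ + a * x₁)) (N v2 t)
        ≡⟨ cong (λ c → (M x t + - x₁ * t₁) + mutationTerm (- (x₂ + a * x₁)) c) (mutate1-v2-nonNeg M M-pivots {w} 0≤t₁) ⟩
      (M x t + - x₁ * t₁) + mutationTerm (- (x₂ + a * x₁)) t₂
        ≡⟨ cong (λ c → (M x t + - x₁ * t₁) + c) (mutationTerm-nonNeg (ℤₚ.neg-mono-≤ y≤0) 0≤t₂) ⟩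
      (M x t + - x₁ * t₁) + - (x₂ + a * x₁) * t₂         ≡⟨ regroup (M x t) a x₁ x₂ t₁ t₂ ⟩
      M x t - pairing a (column M x) (column M t)        ∎
      where
      N = mutate v1 M
      Nₓₜ : N x t ≡ M x t + - x₁ * t₁
      Nₓₜ = trans (mutate-offPivot v1 M other≢v1 other≢v1)
                  (cong (λ c → M x t + c) (trans (cong (λ c → mutationTerm c t₁) (M-quiver x v1))
                                                 (mutationTerm-nonNeg (ℤₚ.neg-mono-≤ x₁≤0) 0≤t₁)))
      Nₓ₂ : N x v2 ≡ - (x₂ + a * x₁)
      Nₓ₂ = row-entry {B = N} {x} {v2} (mutate-isQuiver v1 M-quiver) (mutate1-v2-nonPos M M-pivots x₁≤0)
      regroup : ∀ b a x₁ x₂ t₁ t₂ → (b + - x₁ * t₁) + - (x₂ + a * x₁) * t₂ ≡ b - (x₁ * t₁ + x₂ * t₂ + a * x₁ * t₂)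
      regroup = solve-∀

    mutate21-fixes-nonPos : NonPos (column M x) → NonPos (column M t) → mutate21 M x t ≡ M x t
    mutate21-fixes-nonPos (x₁≤0 , x₂≤0) (t₁≤0 , t₂≤0) = begin
      mutate v1 N x t                        ≡⟨ mutate-offPivot v1 N other≢v1 other≢v1 ⟩
      N x t + mutationTerm (N x v1) (N v1 t) ≡⟨ plus-zero (mutationTerm-nonNeg-nonPos 0≤Nₓ₁ Nₜ₁≤0) ⟩
      N x t                                  ≡⟨ mutate-offPivot v2 M other≢v2 other≢v2 ⟩
      M x t + mutationTerm (M x v2) t₂       ≡⟨ plus-zero (mutationTerm-nonNeg-nonPos (row-nonNeg {B = M} {x} {v2} M-quiver x₂≤0) t₂≤0) ⟩
      M x t                                  ∎
      where
      N = mutate v2 M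
      0≤Nₓ₁ : 0ℤ ≤ N x v1
      0≤Nₓ₁ = row-nonNeg {B = N} {x} {v1} (mutate-isQuiver v2 M-quiver) (subst (_≤ 0ℤ) (sym (mutate2-v1-nonPos M M-pivots x₂≤0)) x₁≤0)
      Nₜ₁≤0 : N v1 t ≤ 0ℤ
      Nₜ₁≤0 = subst (_≤ 0ℤ) (sym (mutate2-v1-nonPos M M-pivots {w} t₂≤0)) t₁≤0

    mutate21-pairing : NonPos (column M x) → Ready21 a (column M t) →
                       mutate21 M x t ≡ M x t - pairing a (column M x) (column M t)
    mutate21-pairing (x₁≤0 , x₂≤0) (0≤t₂ , 0≤s) = begin
      mutate v1 N x t                                ≡⟨ mutate-offPivot v1 N other≢v1 other≢v1 ⟩
      N x t + mutationTerm (N x v1) (N v1 t)         ≡⟨ cong₂ (λ b c → b + mutationTerm c (N v1 t)) Nₓₜ Nₓ₁ ⟩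
      (M x t + - x₂ * t₂) + mutationTerm (- x₁) (N v1 t)
        ≡⟨ cong (λ c → (M x t + - x₂ * t₂) + mutationTerm (- x₁) c) (mutate2-v1-nonNeg M M-pivots {w} 0≤t₂) ⟩
      (M x t + - x₂ * t₂) + mutationTerm (- x₁) (t₁ + a * t₂)
        ≡⟨ cong (λ c → (M x t + - x₂ * t₂) + c) (mutationTerm-nonNeg (ℤₚ.neg-mono-≤ x₁≤0) 0≤s) ⟩
      (M x t + - x₂ * t₂) + - x₁ * (t₁ + a * t₂)     ≡⟨ regroup (M x t) a x₁ x₂ t₁ t₂ ⟩
      M x t - pairing a (column M x) (column M t)    ∎
      where
      N = mutate v2 M
      Nₓₜ : N x t ≡ M x t + - x₂ * t₂
      Nₓₜ = trans (mutate-offPivot v2 M other≢v2 other≢v2)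
                  (cong (λ c → M x t + c) (trans (cong (λ c → mutationTerm c t₂) (M-quiver x v2))
                                                 (mutationTerm-nonNeg (ℤₚ.neg-mono-≤ x₂≤0) 0≤t₂)))
      Nₓ₁ : N x v1 ≡ - x₁
      Nₓ₁ = row-entry {B = N} {x} {v1} (mutate-isQuiver v2 M-quiver) (mutate2-v1-nonPos M M-pivots x₂≤0)
      regroup : ∀ b a x₁ x₂ t₁ t₂ → (b + - x₂ * t₂) + - x₁ * (t₁ + a * t₂) ≡ b - (x₁ * t₁ + x₂ * t₂ + a * x₁ * t₂)
      regroup = solve-∀

AlongOrbit : ∀ {A : Set} → (A → A) → (A → Set) → ℕ → A → Set
AlongOrbit f P zero    x = ⊤
AlongOrbit f P (suc i) x = P x × AlongOrbit f P i (f x)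

module _ {A : Set} {f : A → A} where

  along-invariant : ∀ {P I : A → Set} → (∀ {x} → I x → P x) → (∀ {x} → I x → I (f x)) →
                    ∀ i {x} → I x → AlongOrbit f P i x
  along-invariant I⇒P I-step zero    _   = tt
  along-invariant {P} {I} I⇒P I-step (suc i) {x} Ix = I⇒P Ix , along-invariant {P} {I} I⇒P I-step i {f x} (I-step {x} Ix)

  iterate-invariant : ∀ {I : A → Set} → (∀ {x} → I x → I (f x)) → ∀ i {x} → I x → I (iterate f x i)
  iterate-invariant I-step zero    Ix = Ix
  iterate-invariant {I} I-step (suc i) {x} Ix = iterate-invariant {I} I-step i {f x} (I-step {x} Ix)

  iterate-comm : ∀ i x → iterate f (f x) i ≡ f (iterate f x i)
  iterate-comm zero    x = refl
  iterate-comm (suc i) x = iterate-comm i (f x)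

module _ {m : ℕ} {a : ℤ} (0≤a : 0ℤ ≤ a) where

  alt12-pivots : ∀ i {M : Matrix (2 ℕ.+ m)} → Pivots a M → Pivots a (mutateSeq (alt12 i) M)
  alt12-pivots zero    M-pivots = M-pivots
  alt12-pivots (suc i) M-pivots = alt12-pivots i (mutate12-pivots 0≤a M-pivots)

  alt21-pivots : ∀ i {M : Matrix (2 ℕ.+ m)} → Pivots a M → Pivots a (mutateSeq (alt21 i) M)
  alt21-pivots zero    M-pivots = M-pivots
  alt21-pivots (suc i) M-pivots = alt21-pivots i (mutate21-pivots 0≤a M-pivots)

  alt12-column : ∀ i (M : Matrix (2 ℕ.+ m)) → Pivots a M → ∀ {z} →
                 AlongOrbit (round12 a) (Ready12 a) i (column M (suc (suc z))) →
                 column (mutateSeq (alt12 i) M) (suc (suc z)) ≡ iterate (round12 a) (column M (suc (suc z))) i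
  alt12-column zero    M M-pivots _               = refl
  alt12-column (suc i) M M-pivots {z} (ready , rest) =
    trans (alt12-column i (mutate12 M) (mutate12-pivots 0≤a M-pivots)
                        (subst (AlongOrbit (round12 a) (Ready12 a) i) (sym step) rest))
          (cong (λ c → iterate (round12 a) c i) step)
    where
    step = mutate12-column 0≤a M M-pivots ready

  alt21-column : ∀ i (M : Matrix (2 ℕ.+ m)) → Pivots a M → ∀ {z} →
                 AlongOrbit (round21 a) (Ready21 a) i (column M (suc (suc z))) →
                 column (mutateSeq (alt21 i) M) (suc (suc z)) ≡ iterate (round21 a) (column M (suc (suc z))) i
  alt21-column zero    M M-pivots _               = refl
  alt21-column (suc i) M M-pivots {z} (ready , rest) =
    trans (alt21-column i (mutate21 M) (mutate21-pivots 0≤a M-pivots)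
                        (subst (AlongOrbit (round21 a) (Ready21 a) i) (sym step) rest))
          (cong (λ c → iterate (round21 a) c i) step)
    where
    step = mutate21-column 0≤a M M-pivots ready

  alt12-fixes : ∀ i (M : Matrix (2 ℕ.+ m)) → IsQuiver M → Pivots a M → ∀ {z w} →
                AlongOrbit (round12 a) (Ready12 a) i (column M (suc (suc z))) →
                AlongOrbit (round12 a) (Ready12 a) i (column M (suc (suc w))) →
                mutateSeq (alt12 i) M (suc (suc z)) (suc (suc w)) ≡ M (suc (suc z)) (suc (suc w))
  alt12-fixes zero    M M-quiver M-pivots _ _ = refl
  alt12-fixes (suc i) M M-quiver M-pivots (x-ready , x-rest) (t-ready , t-rest) =
    trans (alt12-fixes i (mutate12 M) (mutateSeq-isQuiver (v1 ∷ v2 ∷ []) M-quiver) (mutate12-pivots 0≤a M-pivots)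
                       (subst (AlongOrbit (round12 a) (Ready12 a) i) (sym (mutate12-column 0≤a M M-pivots x-ready)) x-rest)
                       (subst (AlongOrbit (round12 a) (Ready12 a) i) (sym (mutate12-column 0≤a M M-pivots t-ready)) t-rest))
          (mutate12-fixes 0≤a M M-quiver M-pivots x-ready t-ready)

module _ (a : ℤ) where

  round12-round21 : ∀ x → round12 a (round21 a x) ≡ x
  round12-round21 (x₁ , x₂) = cong₂ _,_ (first a x₁ x₂) (second a x₁ x₂)
    where
    first : ∀ a x₁ x₂ → - (- (x₁ + a * x₂)) + a * ((- x₂ + a * (x₁ + a * x₂)) + a * (- (x₁ + a * x₂))) ≡ x₁
    first = solve-∀
    second : ∀ a x₁ x₂ → - ((- x₂ + a * (x₁ + a * x₂)) + a * (- (x₁ + a * x₂))) ≡ x₂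
    second = solve-∀

  round21-round12 : ∀ x → round21 a (round12 a x) ≡ x
  round21-round12 (x₁ , x₂) = cong₂ _,_ (first a x₁ x₂) (second a x₁ x₂)
    where
    first : ∀ a x₁ x₂ → - ((- x₁ + a * (x₂ + a * x₁)) + a * (- (x₂ + a * x₁))) ≡ x₁
    first = solve-∀
    second : ∀ a x₁ x₂ → - (- (x₂ + a * x₁)) + a * ((- x₁ + a * (x₂ + a * x₁)) + a * (- (x₂ + a * x₁))) ≡ x₂
    second = solve-∀

  minus-pairing-negateˡ : ∀ b x y → b - pairing a (negatePair x) y ≡ b + pairing a x y
  minus-pairing-negateˡ b (x₁ , x₂) (y₁ , y₂) = identity a b x₁ x₂ y₁ y₂
    where
    identity : ∀ a b x₁ x₂ y₁ y₂ → b - ((- x₁) * y₁ + (- x₂) * y₂ + a * (- x₁) * y₂) ≡ b + (x₁ * y₁ + x₂ * y₂ + a * x₁ * y₂)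
    identity = solve-∀

  minus-pairing-negateʳ : ∀ b x y → b - pairing a x y ≡ b + pairing a x (negatePair y)
  minus-pairing-negateʳ b (x₁ , x₂) (y₁ , y₂) = identity a b x₁ x₂ y₁ y₂
    where
    identity : ∀ a b x₁ x₂ y₁ y₂ → b - (x₁ * y₁ + x₂ * y₂ + a * x₁ * y₂) ≡ b + (x₁ * (- y₁) + x₂ * (- y₂) + a * x₁ * (- y₂))
    identity = solve-∀

  pairing-round12 : ∀ x y → pairing a x (round12 a y) ≡ pairing a (round21 a x) y
  pairing-round12 (x₁ , x₂) (y₁ , y₂) = identity a x₁ x₂ y₁ y₂
    where
    identity : ∀ a x₁ x₂ y₁ y₂ →
      x₁ * (- y₁ + a * (y₂ + a * y₁)) + x₂ * (- (y₂ + a * y₁)) + a * x₁ * (- (y₂ + a * y₁))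
      ≡ (- (x₁ + a * x₂)) * y₁ + (- x₂ + a * (x₁ + a * x₂)) * y₂ + a * (- (x₁ + a * x₂)) * y₂
    identity = solve-∀

  pairing-iterate : ∀ i x y → pairing a x (iterate (round12 a) y i) ≡ pairing a (iterate (round21 a) x i) y
  pairing-iterate zero    x y = refl
  pairing-iterate (suc i) x y = begin
    pairing a x (iterate (round12 a) (round12 a y) i)    ≡⟨ cong (pairing a x) (iterate-comm i y) ⟩
    pairing a x (round12 a (iterate (round12 a) y i))    ≡⟨ pairing-round12 x _ ⟩
    pairing a (round21 a x) (iterate (round12 a) y i)    ≡⟨ pairing-iterate i (round21 a x) y ⟩
    pairing a (iterate (round21 a) (round21 a x) i) y    ∎

private
  nonNeg-+ : ∀ {x y} → 0ℤ ≤ x → 0ℤ ≤ y → 0ℤ ≤ x + y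
  nonNeg-+ = ℤₚ.+-mono-≤

  nonNeg-* : ∀ {x y} → 0ℤ ≤ x → 0ℤ ≤ y → 0ℤ ≤ x * y
  nonNeg-* {+ m} {+ n} _ _ = subst (0ℤ ≤_) (ℤₚ.pos-* m n) (+≤+ z≤n)

  nonNeg-combination : ∀ {y} c d {u v} → y ≡ c * u + d * v → 0ℤ ≤ c → 0ℤ ≤ d → 0ℤ ≤ u → 0ℤ ≤ v → 0ℤ ≤ y
  nonNeg-combination c d y≡ 0≤c 0≤d 0≤u 0≤v =
    subst (0ℤ ≤_) (sym y≡) (nonNeg-+ (nonNeg-* 0≤c 0≤u) (nonNeg-* 0≤d 0≤v))

  nonPos : ∀ {x} → 0ℤ ≤ - x → x ≤ 0ℤ
  nonPos {x} 0≤-x = subst (_≤ 0ℤ) (ℤₚ.neg-involutive x) (ℤₚ.neg-mono-≤ 0≤-x)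

-- With a = 2 + e, two simplicial cones of columns that the rounds keep in the regime where
-- they act linearly. In the coordinates (γ, δ) that define each cone, round21 and round12
-- act by matrices with nonnegative entries, which is where a ≥ 2 is used.
module Cones (e : ℕ) where

  a : ℤ
  a = + 2 + + e

  private
    ε = + e

    lit : ∀ n → 0ℤ ≤ + n
    lit n = +≤+ z≤n

    0≤ε : 0ℤ ≤ ε
    0≤ε = lit e

    0≤1+ε : 0ℤ ≤ + 1 + ε
    0≤1+ε = lit (suc e)

    0≤a : 0ℤ ≤ a
    0≤a = lit (2 ℕ.+ e)

    0≤ε[2+ε] : 0ℤ ≤ ε * (+ 2 + ε)
    0≤ε[2+ε] = nonNeg-* 0≤ε 0≤a

    0≤1+ε[3+ε] : 0ℤ ≤ + 1 + ε * (+ 3 + ε)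
    0≤1+ε[3+ε] = nonNeg-+ (lit 1) (nonNeg-* 0≤ε (lit (3 ℕ.+ e)))

    0≤[1+ε][3+ε] : 0ℤ ≤ (+ 1 + ε) * (+ 3 + ε)
    0≤[1+ε][3+ε] = nonNeg-* 0≤1+ε (lit (3 ℕ.+ e))

  ForwardCone : ℤ × ℤ → Set
  ForwardCone (x₁ , x₂) = 0ℤ ≤ - (x₂ + a * x₁) × 0ℤ ≤ x₂ + (+ 1 + ε) * x₁

  BackwardCone : ℤ × ℤ → Set
  BackwardCone (x₁ , x₂) = 0ℤ ≤ - x₁ × 0ℤ ≤ - (x₂ + (+ 1 + ε) * x₁)

  forward⇒ready12 : ∀ {x} → ForwardCone x → Ready12 a x
  forward⇒ready12 {x₁ , x₂} (0≤γ , 0≤δ) =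
    nonPos (nonNeg-combination (+ 1) (+ 1) (identity ε x₁ x₂) (lit 1) (lit 1) 0≤γ 0≤δ) , nonPos 0≤γ
    where
    identity : ∀ e x₁ x₂ → - x₁ ≡ + 1 * (- (x₂ + (+ 2 + e) * x₁)) + + 1 * (x₂ + (+ 1 + e) * x₁)
    identity = solve-∀

  forward⇒ready21 : ∀ {x} → ForwardCone x → Ready21 a x
  forward⇒ready21 {x₁ , x₂} (0≤γ , 0≤δ) =
    nonNeg-combination (+ 1 + ε) a (second ε x₁ x₂) 0≤1+ε 0≤a 0≤γ 0≤δ ,
    nonNeg-combination (+ 1 + ε * (+ 3 + ε)) ((+ 1 + ε) * (+ 3 + ε)) (sum ε x₁ x₂) 0≤1+ε[3+ε] 0≤[1+ε][3+ε] 0≤γ 0≤δ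
    where
    second : ∀ e x₁ x₂ → x₂ ≡ (+ 1 + e) * (- (x₂ + (+ 2 + e) * x₁)) + (+ 2 + e) * (x₂ + (+ 1 + e) * x₁)
    second = solve-∀
    sum : ∀ e x₁ x₂ → x₁ + (+ 2 + e) * x₂ ≡
          (+ 1 + e * (+ 3 + e)) * (- (x₂ + (+ 2 + e) * x₁)) + ((+ 1 + e) * (+ 3 + e)) * (x₂ + (+ 1 + e) * x₁)
    sum = solve-∀

  round21-forward : ∀ {x₁ x₂} → 0ℤ ≤ x₂ → 0ℤ ≤ x₁ + (+ 1 + ε) * x₂ → ForwardCone (round21 a (x₁ , x₂))
  round21-forward {x₁} {x₂} 0≤x₂ 0≤δ =
    subst (0ℤ ≤_) (sym (first ε x₁ x₂)) 0≤x₂ , subst (0ℤ ≤_) (sym (second ε x₁ x₂)) 0≤δ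
    where
    first : ∀ e x₁ x₂ → - ((- x₂ + (+ 2 + e) * (x₁ + (+ 2 + e) * x₂)) + (+ 2 + e) * (- (x₁ + (+ 2 + e) * x₂))) ≡ x₂
    first = solve-∀
    second : ∀ e x₁ x₂ → (- x₂ + (+ 2 + e) * (x₁ + (+ 2 + e) * x₂)) + (+ 1 + e) * (- (x₁ + (+ 2 + e) * x₂))
                         ≡ x₁ + (+ 1 + e) * x₂
    second = solve-∀

  forward-round21 : ∀ {x} → ForwardCone x → ForwardCone (round21 a x)
  forward-round21 {x₁ , x₂} cone@(0≤γ , 0≤δ) =
    round21-forward {x₁} {x₂} (proj₁ (forward⇒ready21 cone))
      (nonNeg-combination (ε * (+ 2 + ε)) (+ 1 + ε * (+ 3 + ε)) (identity ε x₁ x₂) 0≤ε[2+ε] 0≤1+ε[3+ε] 0≤γ 0≤δ)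
    where
    identity : ∀ e x₁ x₂ → x₁ + (+ 1 + e) * x₂ ≡
               (e * (+ 2 + e)) * (- (x₂ + (+ 2 + e) * x₁)) + (+ 1 + e * (+ 3 + e)) * (x₂ + (+ 1 + e) * x₁)
    identity = solve-∀

  nonNeg-round21 : ∀ {x} → NonNeg x → ForwardCone (round21 a x)
  nonNeg-round21 {x₁ , x₂} (0≤x₁ , 0≤x₂) = round21-forward {x₁} {x₂} 0≤x₂ (nonNeg-+ 0≤x₁ (nonNeg-* 0≤1+ε 0≤x₂))

  backward⇒ready12 : ∀ {x} → BackwardCone x → Ready12 a x
  backward⇒ready12 {x₁ , x₂} (0≤α , 0≤β) =
    nonPos 0≤α , nonPos (nonNeg-combination (+ 1) (+ 1) (identity ε x₁ x₂) (lit 1) (lit 1) 0≤α 0≤β)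
    where
    identity : ∀ e x₁ x₂ → - (x₂ + (+ 2 + e) * x₁) ≡ + 1 * (- x₁) + + 1 * (- (x₂ + (+ 1 + e) * x₁))
    identity = solve-∀

  backward-round12 : ∀ {x} → BackwardCone x → BackwardCone (round12 a x)
  backward-round12 {x₁ , x₂} (0≤α , 0≤β) =
    nonNeg-combination (+ 1 + ε) a (first ε x₁ x₂) 0≤1+ε 0≤a 0≤α 0≤β ,
    nonNeg-combination (ε * (+ 2 + ε)) (+ 1 + ε * (+ 3 + ε)) (second ε x₁ x₂) 0≤ε[2+ε] 0≤1+ε[3+ε] 0≤α 0≤β
    where
    first : ∀ e x₁ x₂ → - (- x₁ + (+ 2 + e) * (x₂ + (+ 2 + e) * x₁)) ≡
            (+ 1 + e) * (- x₁) + (+ 2 + e) * (- (x₂ + (+ 1 + e) * x₁))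
    first = solve-∀
    second : ∀ e x₁ x₂ → - (- (x₂ + (+ 2 + e) * x₁) + (+ 1 + e) * (- x₁ + (+ 2 + e) * (x₂ + (+ 2 + e) * x₁))) ≡
             (e * (+ 2 + e)) * (- x₁) + (+ 1 + e * (+ 3 + e)) * (- (x₂ + (+ 1 + e) * x₁))
    second = solve-∀

  backward⇒ready21-round12 : ∀ {x} → BackwardCone x → Ready21 a (round12 a x)
  backward⇒ready21-round12 {x₁ , x₂} (0≤α , 0≤β) =
    nonNeg-combination (+ 1) (+ 1) (first ε x₁ x₂) (lit 1) (lit 1) 0≤α 0≤β ,
    subst (0ℤ ≤_) (sym (second ε x₁ x₂)) 0≤α
    where
    first : ∀ e x₁ x₂ → - (x₂ + (+ 2 + e) * x₁) ≡ + 1 * (- x₁) + + 1 * (- (x₂ + (+ 1 + e) * x₁))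
    first = solve-∀
    second : ∀ e x₁ x₂ → (- x₁ + (+ 2 + e) * (x₂ + (+ 2 + e) * x₁)) + (+ 2 + e) * (- (x₂ + (+ 2 + e) * x₁)) ≡ - x₁
    second = solve-∀

  negate-backward : ∀ {x} → NonNeg x → BackwardCone (negatePair x)
  negate-backward {x₁ , x₂} (0≤x₁ , 0≤x₂) =
    subst (0ℤ ≤_) (sym (ℤₚ.neg-involutive x₁)) 0≤x₁ ,
    subst (0ℤ ≤_) (sym (identity ε x₁ x₂)) (nonNeg-+ 0≤x₂ (nonNeg-* 0≤1+ε 0≤x₁))
    where
    identity : ∀ e x₁ x₂ → - (- x₂ + (+ 1 + e) * (- x₁)) ≡ x₂ + (+ 1 + e) * x₁
    identity = solve-∀

  nonNeg-along21 : ∀ {x} → NonNeg x → ∀ i → AlongOrbit (round21 a) (Ready21 a) i x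
  nonNeg-along21 _                     zero    = tt
  nonNeg-along21 {x} quadrant@(0≤x₁ , 0≤x₂) (suc i) =
    (0≤x₂ , nonNeg-+ 0≤x₁ (nonNeg-* 0≤a 0≤x₂)) ,
    along-invariant {P = Ready21 a} {I = ForwardCone} (λ {y} → forward⇒ready21 {y}) (λ {y} → forward-round21 {y}) i
                    (nonNeg-round21 {x} quadrant)

  backward-along12 : ∀ {x} → BackwardCone x → ∀ i → AlongOrbit (round12 a) (Ready12 a) i x
  backward-along12 cone i =
    along-invariant {P = Ready12 a} {I = BackwardCone} (λ {y} → backward⇒ready12 {y}) (λ {y} → backward-round12 {y}) i cone

  unwinding-along12 : ∀ {x} → NonNeg x → ∀ i → AlongOrbit (round12 a) (Ready12 a) i (iterate (round21 a) x i)
  unwinding-along12 _                  zero    = tt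
  unwinding-along12 {x} quadrant (suc i) =
    forward⇒ready12 {iterate (round21 a) (round21 a x) i}
      (iterate-invariant {I = ForwardCone} (λ {y} → forward-round21 {y}) i (nonNeg-round21 {x} quadrant)) ,
    subst (AlongOrbit (round12 a) (Ready12 a) i) (sym back) (unwinding-along12 quadrant i)
    where
    back : round12 a (iterate (round21 a) (round21 a x) i) ≡ iterate (round21 a) x i
    back = trans (cong (round12 a) (iterate-comm i x)) (round12-round21 a _)

module _ {n : ℕ} where

  restrict-isQuiver : ∀ {B : Matrix (suc n)} → IsQuiver B → IsQuiver (restrict B)
  restrict-isQuiver B-quiver i j = B-quiver (inject₁ i) (inject₁ j)

  ≐-fromRestrict : ∀ {A B : Matrix (suc n)} → IsQuiver A → IsQuiver B → restrict A ≐ restrict B →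
                   (∀ i → A (inject₁ i) (fromℕ n) ≡ B (inject₁ i) (fromℕ n)) → A ≐ B
  ≐-fromRestrict {A} {B} A-quiver B-quiver same-block same-last i j = by-view (view i) (view j)
    where
    by-view : ∀ {i j} → View i → View j → A i j ≡ B i j
    by-view ‵fromℕ        ‵fromℕ        =
      trans (isQuiver-diagonal A-quiver _) (sym (isQuiver-diagonal B-quiver _))
    by-view (‵inject₁ i′) ‵fromℕ        = same-last i′
    by-view ‵fromℕ        (‵inject₁ j′) =
      trans (A-quiver _ _) (trans (cong -_ (same-last j′)) (sym (B-quiver _ _)))
    by-view (‵inject₁ i′) (‵inject₁ j′) = same-block i′ j′

module _ {m : ℕ} where

  ≐-fromColumns : ∀ {A B : Matrix (2 ℕ.+ m)} → IsQuiver A → IsQuiver B → A v1 v2 ≡ B v1 v2 →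
                  (∀ z → column A (suc (suc z)) ≡ column B (suc (suc z))) →
                  (∀ z w → A (suc (suc z)) (suc (suc w)) ≡ B (suc (suc z)) (suc (suc w))) → A ≐ B
  ≐-fromColumns {A} {B} A-quiver B-quiver same-pivot same-column same-rest = same
    where
    diagonal : ∀ i → A i i ≡ B i i
    diagonal i = trans (isQuiver-diagonal A-quiver i) (sym (isQuiver-diagonal B-quiver i))
    transposed : ∀ {i j} → A j i ≡ B j i → A i j ≡ B i j
    transposed {i} {j} eq = trans (A-quiver i j) (trans (cong -_ eq) (sym (B-quiver i j)))
    same : A ≐ B
    same zero          zero          = diagonal zero
    same zero          (suc zero)    = same-pivot
    same zero          (suc (suc w)) = cong proj₁ (same-column w)
    same (suc zero)    zero          = transposed same-pivot
    same (suc zero)    (suc zero)    = diagonal (suc zero)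
    same (suc zero)    (suc (suc w)) = cong proj₂ (same-column w)
    same (suc (suc z)) zero          = transposed (cong proj₁ (same-column z))
    same (suc (suc z)) (suc zero)    = transposed (cong proj₂ (same-column z))
    same (suc (suc z)) (suc (suc w)) = same-rest z w

private
  threshold-step : ∀ {t x} → x ≢ t → does (t ℕ.≤? x) ≡ does (suc t ℕ.≤? x)
  threshold-step {t} {x} x≢t with t ℕ.≤? x
  ... | yes t≤x = trans (dec-true (t ℕ.≤? x) t≤x) (sym (dec-true (suc t ℕ.≤? x) (ℕₚ.≤∧≢⇒< t≤x (x≢t ∘ sym))))
  ... | no  t≰x = trans (dec-false (t ℕ.≤? x) t≰x) (sym (dec-false (suc t ℕ.≤? x) (t≰x ∘ ℕₚ.<⇒≤)))

-- Mutating at the vertices N−1, N−2, …, b (0-based) in this order, each of which is a sink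
-- when its turn comes, reverses all arrows between {b, …, N−1} and the other vertices.
module SinkPhase {N : ℕ} (b : ℕ) (S : Matrix (suc N)) (S-quiver : IsQuiver S)
  (S-upper : ∀ i j → i Fin.< j → 0ℤ ≤ S (inject₁ i) (inject₁ j))
  (S-last : ∀ i → b ℕ.≤ toℕ i → 0ℤ ℤ.< S (fromℕ N) (inject₁ i)) where

  flippedFrom : ℕ → Fin (suc N) → Bool
  flippedFrom t i = does (t ℕ.≤? toℕ i) ∧ does (toℕ i ℕ.<? N)

  flippedFrom-last : ∀ t → flippedFrom t (fromℕ N) ≡ false
  flippedFrom-last t =
    trans (cong (does (t ℕ.≤? toℕ (fromℕ N)) ∧_) (dec-false (toℕ (fromℕ N) ℕ.<? N) (ℕₚ.<-irrefl (Finₚ.toℕ-fromℕ N))))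
          (Boolₚ.∧-zeroʳ _)

  flippedFrom-inject₁ : ∀ t i → flippedFrom t (inject₁ i) ≡ does (t ℕ.≤? toℕ i)
  flippedFrom-inject₁ t i rewrite Finₚ.toℕ-inject₁ i =
    trans (cong (does (t ℕ.≤? toℕ i) ∧_) (dec-true (toℕ i ℕ.<? N) (Finₚ.toℕ<n i))) (Boolₚ.∧-identityʳ _)

  private
    C : ℕ → Matrix (suc N)
    C t = conjugate (flippedFrom t) S

    sink-step : ∀ (k : Fin N) → b ℕ.≤ toℕ k →
                mutate (inject₁ k) (C (suc (toℕ k))) ≐ C (toℕ k) × ¬ Isolated (C (suc (toℕ k))) (inject₁ k)
    sink-step k b≤k = mutate-atSink-conjugate (inject₁ k) S-quiver sink k-unflipped k-flipped others , non-isolated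
      where
      t = toℕ k
      k-unflipped : flippedFrom (suc t) (inject₁ k) ≡ false
      k-unflipped = trans (flippedFrom-inject₁ (suc t) k) (dec-false (suc t ℕ.≤? t) (ℕₚ.<-irrefl refl))
      k-flipped : flippedFrom t (inject₁ k) ≡ true
      k-flipped = trans (flippedFrom-inject₁ t k) (dec-true (t ℕ.≤? t) ℕₚ.≤-refl)
      others : ∀ i → i ≢ inject₁ k → flippedFrom t i ≡ flippedFrom (suc t) i
      others i i≢k = cong (_∧ does (toℕ i ℕ.<? N))
        (threshold-step (λ eq → i≢k (Finₚ.toℕ-injective (trans eq (sym (Finₚ.toℕ-inject₁ k))))))
      column-k : ∀ i → signed (flippedFrom (suc t) i) (S i (inject₁ k)) ≡ C (suc t) i (inject₁ k)
      column-k i = cong (λ c → signed (flippedFrom (suc t) i) (signed c (S i (inject₁ k)))) (sym k-unflipped)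
      sink-by-view : ∀ {i} → View i → 0ℤ ≤ signed (flippedFrom (suc t) i) (S i (inject₁ k))
      sink-by-view ‵fromℕ =
        subst (λ c → 0ℤ ≤ signed c (S (fromℕ N) (inject₁ k))) (sym (flippedFrom-last (suc t))) (ℤₚ.<⇒≤ (S-last k b≤k))
      sink-by-view (‵inject₁ i) with Finₚ.<-cmp i k
      ... | tri< i<k _ _ =
        subst (λ c → 0ℤ ≤ signed c (S (inject₁ i) (inject₁ k)))
              (sym (trans (flippedFrom-inject₁ (suc t) i) (dec-false (suc t ℕ.≤? toℕ i) (ℕₚ.<-asym i<k))))
              (S-upper i k i<k)
      ... | tri≈ _ refl _ =
        subst (0ℤ ≤_) (sym (trans (cong (signed (flippedFrom (suc t) (inject₁ k))) (isQuiver-diagonal S-quiver (inject₁ k)))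
                                  (signed-zero (flippedFrom (suc t) (inject₁ k))))) ℤₚ.≤-refl
      ... | tri> _ _ k<i =
        subst (λ c → 0ℤ ≤ signed c (S (inject₁ i) (inject₁ k)))
              (sym (trans (flippedFrom-inject₁ (suc t) i) (dec-true (suc t ℕ.≤? toℕ i) k<i)))
              (subst (0ℤ ≤_) (S-quiver (inject₁ k) (inject₁ i)) (S-upper k i k<i))
      sink : ∀ i → 0ℤ ≤ C (suc t) i (inject₁ k)
      sink i = subst (0ℤ ≤_) (column-k i) (sink-by-view (view i))
      non-isolated : ¬ Isolated (C (suc t)) (inject₁ k)
      non-isolated isolated =
        ℤₚ.<⇒≢ (S-last k b≤k) (sym (trans (cong (λ c → signed c (S (fromℕ N) (inject₁ k))) (sym (flippedFrom-last (suc t))))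
                                          (trans (column-k (fromℕ N)) (isolated (fromℕ N)))))

  sink-phase : ∀ m (g : Fin m → Fin N) → (∀ i → toℕ (g i) ≡ toℕ i ℕ.+ b) → m ℕ.+ b ℕ.≤ N →
    mutateSeq (reverse (tabulate (inject₁ ∘ g))) (conjugate (flippedFrom (m ℕ.+ b)) S) ≐ conjugate (flippedFrom b) S ×
    NonIsolatedSteps (conjugate (flippedFrom (m ℕ.+ b)) S) (reverse (tabulate (inject₁ ∘ g)))
  sink-phase zero    g g-index bound = (λ _ _ → refl) , tt
  sink-phase (suc m) g g-index bound rewrite reverse-tabulate m (inject₁ ∘ g) =
    (λ i j → trans (mutateSeq-cong rest step i j) (proj₁ later i j)) ,
    non-isolated , nonIsolatedSteps-cong rest (λ i j → sym (step i j)) (proj₂ later)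
    where
    k = g (fromℕ m)
    rest = reverse (tabulate (inject₁ ∘ g ∘ inject₁))
    k-index : toℕ k ≡ m ℕ.+ b
    k-index = trans (g-index (fromℕ m)) (cong (ℕ._+ b) (Finₚ.toℕ-fromℕ m))
    current = subst (λ t → mutate (inject₁ k) (C (suc t)) ≐ C t × ¬ Isolated (C (suc t)) (inject₁ k)) k-index
                    (sink-step k (subst (b ℕ.≤_) (sym k-index) (ℕₚ.m≤n+m b m)))
    step = proj₁ current
    non-isolated = proj₂ current
    later = sink-phase m (g ∘ inject₁) (λ i → trans (g-index (inject₁ i)) (cong (ℕ._+ b) (Finₚ.toℕ-inject₁ i)))
                       (ℕₚ.<⇒≤ bound)

  flippedFrom-empty : ∀ {t} → N ℕ.≤ t → S ≐ conjugate (flippedFrom t) S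
  flippedFrom-empty {t} N≤t i j =
    sym (cong₂ (λ c d → signed c (signed d (S i j))) (unflipped i (toℕ i ℕ.<? N)) (unflipped j (toℕ j ℕ.<? N)))
    where
    unflipped : ∀ i → Dec (toℕ i ℕ.< N) → flippedFrom t i ≡ false
    unflipped i (yes i<N) = cong (_∧ does (toℕ i ℕ.<? N))
      (dec-false (t ℕ.≤? toℕ i) (λ t≤i → ℕₚ.<-irrefl refl (ℕₚ.<-≤-trans i<N (ℕₚ.≤-trans N≤t t≤i))))
    unflipped i (no i≮N) =
      trans (cong (does (t ℕ.≤? toℕ i) ∧_) (dec-false (toℕ i ℕ.<? N) i≮N)) (Boolₚ.∧-zeroʳ _)

-- The mutation cycle

private
  ≥2⇒nonNeg : ∀ {x} → x ℤ.≥ + 2 → 0ℤ ≤ x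
  ≥2⇒nonNeg = ℤₚ.≤-trans (+≤+ z≤n)

  ≥2⇒pos : ∀ {x} → x ℤ.≥ + 2 → 0ℤ ℤ.< x
  ≥2⇒pos = ℤₚ.<-≤-trans (ℤ.+<+ (s≤s z≤n))

module Cycle (p j : ℕ) (R : Matrix (3 ℕ.+ p)) (R-quiver : IsQuiver R)
  (R-upper : ∀ (i l : Fin (3 ℕ.+ p)) → i Fin.< l → R i l ℤ.≥ + 2)
  (e : ℕ) (R₁₂ : R v1 v2 ≡ + 2 + + e)
  (Q : Matrix (4 ℕ.+ p)) (Q-quiver : IsQuiver Q)
  (Q-block : restrict Q ≐ mutateSeq (alt21 (suc j)) R)
  (Q-last : ∀ i → Q (inject₁ i) (fromℕ (3 ℕ.+ p)) ℤ.≥ + 2) where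

  open Cones e

  private
    k = suc j

    0≤a : 0ℤ ≤ a
    0≤a = +≤+ z≤n

    top : Fin (4 ℕ.+ p)
    top = fromℕ (3 ℕ.+ p)

    Y : Fin (1 ℕ.+ p) → Fin (3 ℕ.+ p)
    Y y = suc (suc y)

    X : Fin (1 ℕ.+ p) → Fin (4 ℕ.+ p)
    X y = inject₁ (Y y)

    q : Fin (3 ℕ.+ p) → ℤ
    q i = Q (inject₁ i) top

    f : ℤ × ℤ
    f = negatePair (column Q top)

    r : Fin (1 ℕ.+ p) → ℤ × ℤ
    r y = column R (Y y)

    pivots-nonZero : ∀ {m} {M : Matrix (2 ℕ.+ m)} → Pivots a M → M v1 v2 ≢ 0ℤ × M v2 v1 ≢ 0ℤ
    pivots-nonZero (pivots M₁₂ M₂₁) =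
      (λ eq → a≢0 (trans (sym M₁₂) eq)) , (λ eq → a≢0 (neg≡0 (trans (sym M₂₁) eq)))
      where
      a≢0 : a ≢ 0ℤ
      a≢0 ()
      neg≡0 : ∀ {x} → - x ≡ 0ℤ → x ≡ 0ℤ
      neg≡0 {x} eq = trans (sym (ℤₚ.neg-involutive x)) (cong -_ eq)

    R-pivots : Pivots a R
    R-pivots = pivots R₁₂ (trans (R-quiver v2 v1) (cong -_ R₁₂))

    r-nonNeg : ∀ y → NonNeg (r y)
    r-nonNeg y = ≥2⇒nonNeg (R-upper v1 (Y y) (s≤s z≤n)) , ≥2⇒nonNeg (R-upper v2 (Y y) (s≤s (s≤s z≤n)))

    Q-pivots : Pivots a Q
    Q-pivots = pivots (trans (Q-block v1 v2) (Pivots.pivot₁₂ K-pivots)) (trans (Q-block v2 v1) (Pivots.pivot₂₁ K-pivots))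
      where
      K-pivots = alt21-pivots 0≤a k R-pivots

    Q-column-X : ∀ y → column Q (X y) ≡ iterate (round21 a) (r y) k
    Q-column-X y = trans (cong₂ _,_ (Q-block v1 (Y y)) (Q-block v2 (Y y)))
                         (alt21-column 0≤a k R R-pivots (nonNeg-along21 (r-nonNeg y) k))

    Q-X-along : ∀ y → AlongOrbit (round12 a) (Ready12 a) k (column Q (X y))
    Q-X-along y = subst (AlongOrbit (round12 a) (Ready12 a) k) (sym (Q-column-X y)) (unwinding-along12 (r-nonNeg y) k)

    Q-last-nonNeg : NonNeg (column Q top)
    Q-last-nonNeg = ≥2⇒nonNeg (Q-last v1) , ≥2⇒nonNeg (Q-last v2)

    f-along : ∀ i → AlongOrbit (round12 a) (Ready12 a) i f
    f-along = backward-along12 (negate-backward Q-last-nonNeg)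

    S₁ : Matrix (4 ℕ.+ p)
    S₁ = mutate top Q

    S₁-quiver : IsQuiver S₁
    S₁-quiver = mutate-isQuiver top Q-quiver

    S₁-restrict : restrict S₁ ≐ restrict Q
    S₁-restrict i l = mutate-atSink top Q-quiver top-sink (Finₚ.fromℕ≢inject₁ ∘ sym) (Finₚ.fromℕ≢inject₁ ∘ sym)
      where
      top-sink-by-view : ∀ {i} → View i → 0ℤ ≤ Q i top
      top-sink-by-view ‵fromℕ       = subst (0ℤ ≤_) (sym (isQuiver-diagonal Q-quiver top)) ℤₚ.≤-refl
      top-sink-by-view (‵inject₁ i) = ≥2⇒nonNeg (Q-last i)
      top-sink : ∀ i → 0ℤ ≤ Q i top
      top-sink i = top-sink-by-view (view i)

    S₁-pivots : Pivots a S₁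
    S₁-pivots = pivots (trans (S₁-restrict v1 v2) (Pivots.pivot₁₂ Q-pivots))
                       (trans (S₁-restrict v2 v1) (Pivots.pivot₂₁ Q-pivots))

    S₁-column-top : column S₁ top ≡ f
    S₁-column-top = cong₂ _,_ (mutate-pivotCol top Q v1) (mutate-pivotCol top Q v2)

    S₁-X-along : ∀ y → AlongOrbit (round12 a) (Ready12 a) k (column S₁ (X y))
    S₁-X-along y = subst (AlongOrbit (round12 a) (Ready12 a) k)
                         (sym (cong₂ _,_ (S₁-restrict v1 (Y y)) (S₁-restrict v2 (Y y)))) (Q-X-along y)

    S₁-top-along : AlongOrbit (round12 a) (Ready12 a) k (column S₁ top)
    S₁-top-along = subst (AlongOrbit (round12 a) (Ready12 a) k) (sym S₁-column-top) (f-along k)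

    S₂ : Matrix (4 ℕ.+ p)
    S₂ = mutateSeq (alt12 k) S₁

    S₂-quiver : IsQuiver S₂
    S₂-quiver = mutateSeq-isQuiver (alt12 k) S₁-quiver

    S₂-restrict : restrict S₂ ≐ R
    S₂-restrict i l =
      trans (restrict-alt12 k S₁ i l)
            (trans (mutateSeq-cong (alt12 k) (λ i′ l′ → trans (S₁-restrict i′ l′) (Q-block i′ l′)) i l)
                   (alt12-undoes-alt21 k R i l))

    S₂-column-top : column S₂ top ≡ iterate (round12 a) f k
    S₂-column-top = trans (alt12-column 0≤a k S₁ S₁-pivots S₁-top-along)
                          (cong (λ v → iterate (round12 a) v k) S₁-column-top)

    S₂-X-top : ∀ y → S₂ (X y) top ≡ - q (Y y)
    S₂-X-top y = trans (alt12-fixes 0≤a k S₁ S₁-quiver S₁-pivots (S₁-X-along y) S₁-top-along) (mutate-pivotCol top Q (X y))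

    S₂-upper : ∀ i l → i Fin.< l → 0ℤ ≤ S₂ (inject₁ i) (inject₁ l)
    S₂-upper i l i<l = subst (0ℤ ≤_) (sym (S₂-restrict i l)) (≥2⇒nonNeg (R-upper i l i<l))

    S₂-last : ∀ i → 2 ℕ.≤ toℕ i → 0ℤ ℤ.< S₂ top (inject₁ i)
    S₂-last (suc zero)    (s≤s ())
    S₂-last (suc (suc y)) _ =
      subst (0ℤ ℤ.<_) (sym (trans (S₂-quiver top (X y)) (trans (cong -_ (S₂-X-top y)) (ℤₚ.neg-involutive _))))
            (≥2⇒pos (Q-last (Y y)))

    module Sinks = SinkPhase 2 S₂ S₂-quiver S₂-upper S₂-last

    -- The quiver reached from S₂ by mutating at n−1, …, 3 (see sinks below).
    S₃ : Matrix (4 ℕ.+ p)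
    S₃ = conjugate (Sinks.flippedFrom 2) S₂

    sinks : mutateSeq (reverse (tabulate X)) (conjugate (Sinks.flippedFrom ((1 ℕ.+ p) ℕ.+ 2)) S₂) ≐ S₃ ×
            NonIsolatedSteps (conjugate (Sinks.flippedFrom ((1 ℕ.+ p) ℕ.+ 2)) S₂) (reverse (tabulate X))
    sinks = Sinks.sink-phase (1 ℕ.+ p) Y (λ y → ℕₚ.+-comm 2 (toℕ y)) (ℕₚ.≤-reflexive (ℕₚ.+-comm (1 ℕ.+ p) 2))

    S₂-unchanged : S₂ ≐ conjugate (Sinks.flippedFrom ((1 ℕ.+ p) ℕ.+ 2)) S₂
    S₂-unchanged = Sinks.flippedFrom-empty (ℕₚ.≤-reflexive (ℕₚ.+-comm 2 (1 ℕ.+ p)))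

    S₂-flipped-X : ∀ y → Sinks.flippedFrom 2 (X y) ≡ true
    S₂-flipped-X y = Sinks.flippedFrom-inject₁ 2 (Y y)

    S₂-flipped-top : Sinks.flippedFrom 2 top ≡ false
    S₂-flipped-top = Sinks.flippedFrom-last 2

    S₃-quiver : IsQuiver S₃
    S₃-quiver = conjugate-isQuiver (Sinks.flippedFrom 2) S₂-quiver

    S₃-pivots : Pivots a S₃
    S₃-pivots = pivots (trans (S₂-restrict v1 v2) R₁₂) (trans (S₂-restrict v2 v1) (Pivots.pivot₂₁ R-pivots))

    S₃-column-top : column S₃ top ≡ iterate (round12 a) f k
    S₃-column-top = trans (cong₂ _,_ (cong (λ c → signed c (S₂ v1 top)) S₂-flipped-top)
                                     (cong (λ c → signed c (S₂ v2 top)) S₂-flipped-top))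
                          S₂-column-top

    S₃-column-X : ∀ y → column S₃ (X y) ≡ negatePair (r y)
    S₃-column-X y = cong₂ _,_ (trans (cong (λ c → signed c (S₂ v1 (X y))) (S₂-flipped-X y)) (cong -_ (S₂-restrict v1 (Y y))))
                              (trans (cong (λ c → signed c (S₂ v2 (X y))) (S₂-flipped-X y)) (cong -_ (S₂-restrict v2 (Y y))))

    S₃-X-nonPos : ∀ y → NonPos (column S₃ (X y))
    S₃-X-nonPos y = subst NonPos (sym (S₃-column-X y))
                          (ℤₚ.neg-mono-≤ (proj₁ (r-nonNeg y)) , ℤₚ.neg-mono-≤ (proj₂ (r-nonNeg y)))

    S₃-X-top : ∀ y → S₃ (X y) top ≡ q (Y y)
    S₃-X-top y = begin
      S₃ (X y) top     ≡⟨ cong₂ (λ c d → signed c (signed d (S₂ (X y) top))) (S₂-flipped-X y) S₂-flipped-top ⟩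
      - S₂ (X y) top   ≡⟨ cong -_ (S₂-X-top y) ⟩
      - - q (Y y)      ≡⟨ ℤₚ.neg-involutive _ ⟩
      q (Y y)          ∎

    S₃-X-X : ∀ y w → S₃ (X y) (X w) ≡ R (Y y) (Y w)
    S₃-X-X y w = begin
      S₃ (X y) (X w)     ≡⟨ cong₂ (λ c d → signed c (signed d (S₂ (X y) (X w)))) (S₂-flipped-X y) (S₂-flipped-X w) ⟩
      - - S₂ (X y) (X w) ≡⟨ ℤₚ.neg-involutive _ ⟩
      S₂ (X y) (X w)     ≡⟨ S₂-restrict (Y y) (Y w) ⟩
      R (Y y) (Y w)      ∎

    S₄ : Matrix (4 ℕ.+ p)
    S₄ = mutate21 S₃

    S₄-quiver : IsQuiver S₄
    S₄-quiver = mutateSeq-isQuiver (v2 ∷ v1 ∷ []) S₃-quiver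

    S₄-pivots : Pivots a S₄
    S₄-pivots = mutate21-pivots 0≤a S₃-pivots

    S₃-top-ready : Ready21 a (column S₃ top)
    S₃-top-ready = subst (Ready21 a) (sym (trans S₃-column-top (iterate-comm j f)))
      (backward⇒ready21-round12 {iterate (round12 a) f j} (iterate-invariant {I = BackwardCone} (λ {x} → backward-round12 {x}) j
                                                   (negate-backward Q-last-nonNeg)))

    S₄-column-top : column S₄ top ≡ iterate (round12 a) f j
    S₄-column-top = begin
      column S₄ top                                 ≡⟨ mutate21-column 0≤a S₃ S₃-pivots {fromℕ (1 ℕ.+ p)} S₃-top-ready ⟩
      round21 a (column S₃ top)                     ≡⟨ cong (round21 a) (trans S₃-column-top (iterate-comm j f)) ⟩
      round21 a (round12 a (iterate (round12 a) f j)) ≡⟨ round21-round12 a _ ⟩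
      iterate (round12 a) f j                       ∎

    S₄-column-X : ∀ y → column S₄ (X y) ≡ r y
    S₄-column-X y = trans (mutate21-column-nonPos 0≤a S₃ S₃-pivots {inject₁ y} (S₃-X-nonPos y))
                          (trans (cong negatePair (S₃-column-X y)) (negatePair-involutive (r y)))

    S₄-X-X : ∀ y w → S₄ (X y) (X w) ≡ R (Y y) (Y w)
    S₄-X-X y w = trans (mutate21-fixes-nonPos 0≤a S₃ S₃-quiver S₃-pivots {inject₁ y} {inject₁ w} (S₃-X-nonPos y) (S₃-X-nonPos w))
                       (S₃-X-X y w)

    S₄-X-top : ∀ y → S₄ (X y) top ≡ q (Y y) + pairing a (r y) (iterate (round12 a) f k)
    S₄-X-top y = begin
      S₄ (X y) top
        ≡⟨ mutate21-pairing 0≤a S₃ S₃-quiver S₃-pivots {inject₁ y} {fromℕ (1 ℕ.+ p)} (S₃-X-nonPos y) S₃-top-ready ⟩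
      S₃ (X y) top - pairing a (column S₃ (X y)) (column S₃ top)
        ≡⟨ cong₂ (λ b v → b - pairing a v (column S₃ top)) (S₃-X-top y) (S₃-column-X y) ⟩
      q (Y y) - pairing a (negatePair (r y)) (column S₃ top)
        ≡⟨ cong (λ v → q (Y y) - pairing a (negatePair (r y)) v) S₃-column-top ⟩
      q (Y y) - pairing a (negatePair (r y)) (iterate (round12 a) f k)
        ≡⟨ minus-pairing-negateˡ a (q (Y y)) (r y) _ ⟩
      q (Y y) + pairing a (r y) (iterate (round12 a) f k) ∎

    T : Matrix (4 ℕ.+ p)
    T = mutate12 Q

    T-quiver : IsQuiver T
    T-quiver = mutateSeq-isQuiver (v1 ∷ v2 ∷ []) Q-quiver

    T-pivots : Pivots a T
    T-pivots = mutate12-pivots 0≤a Q-pivots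

    T-column-top : column T top ≡ f
    T-column-top = mutate12-column-nonNeg 0≤a Q Q-pivots {fromℕ (1 ℕ.+ p)} Q-last-nonNeg

    T-X-top : ∀ y → T (X y) top ≡ q (Y y) + pairing a (iterate (round21 a) (r y) k) f
    T-X-top y = begin
      T (X y) top
        ≡⟨ mutate12-pairing 0≤a Q Q-quiver Q-pivots {inject₁ y} {fromℕ (1 ℕ.+ p)} (proj₁ (Q-X-along y)) Q-last-nonNeg ⟩
      q (Y y) - pairing a (column Q (X y)) (column Q top)
        ≡⟨ cong (λ v → q (Y y) - pairing a v (column Q top)) (Q-column-X y) ⟩
      q (Y y) - pairing a (iterate (round21 a) (r y) k) (column Q top)
        ≡⟨ minus-pairing-negateʳ a (q (Y y)) (iterate (round21 a) (r y) k) (column Q top) ⟩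
      q (Y y) + pairing a (iterate (round21 a) (r y) k) f ∎

    T-X-along : ∀ y → AlongOrbit (round12 a) (Ready12 a) j (column T (X y))
    T-X-along y = subst (AlongOrbit (round12 a) (Ready12 a) j)
                        (sym (mutate12-column 0≤a Q Q-pivots {inject₁ y} (proj₁ (Q-X-along y)))) (proj₂ (Q-X-along y))

    T-top-along : AlongOrbit (round12 a) (Ready12 a) j (column T top)
    T-top-along = subst (AlongOrbit (round12 a) (Ready12 a) j) (sym T-column-top) (f-along j)

    P : Matrix (4 ℕ.+ p)
    P = mutateSeq (alt12 k) Q

    P-quiver : IsQuiver P
    P-quiver = mutateSeq-isQuiver (alt12 k) Q-quiver

    P-restrict : restrict P ≐ R
    P-restrict i l = trans (restrict-alt12 k Q i l) (trans (mutateSeq-cong (alt12 k) Q-block i l) (alt12-undoes-alt21 k R i l))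

    P-column-top : column P top ≡ iterate (round12 a) f j
    P-column-top = trans (alt12-column 0≤a j T T-pivots {fromℕ (1 ℕ.+ p)} T-top-along)
                         (cong (λ v → iterate (round12 a) v j) T-column-top)

    P-X-top : ∀ y → P (X y) top ≡ T (X y) top
    P-X-top y = alt12-fixes 0≤a j T T-quiver T-pivots {inject₁ y} {fromℕ (1 ℕ.+ p)} (T-X-along y) T-top-along

    S₄-restrict : restrict S₄ ≐ R
    S₄-restrict = ≐-fromColumns (restrict-isQuiver S₄-quiver) R-quiver (trans (Pivots.pivot₁₂ S₄-pivots) (sym R₁₂))
                                S₄-column-X S₄-X-X

    S₄≐P : S₄ ≐ P
    S₄≐P = ≐-fromRestrict S₄-quiver P-quiver (λ i l → trans (S₄-restrict i l) (sym (P-restrict i l))) same-last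
      where
      same-top : column S₄ top ≡ column P top
      same-top = trans S₄-column-top (sym P-column-top)
      same-last : ∀ i → S₄ (inject₁ i) top ≡ P (inject₁ i) top
      same-last zero          = cong proj₁ same-top
      same-last (suc zero)    = cong proj₂ same-top
      same-last (suc (suc y)) = begin
        S₄ (X y) top                                         ≡⟨ S₄-X-top y ⟩
        q (Y y) + pairing a (r y) (iterate (round12 a) f k)  ≡⟨ cong (λ t → q (Y y) + t) (pairing-iterate a k (r y) f) ⟩
        q (Y y) + pairing a (iterate (round21 a) (r y) k) f  ≡⟨ T-X-top y ⟨
        T (X y) top                                          ≡⟨ P-X-top y ⟨
        P (X y) top                                          ∎

    Ydesc : List (Fin (4 ℕ.+ p))
    Ydesc = reverse (tabulate X)

    descending-split : descending (3 ℕ.+ p) ≡ Ydesc ++ alt21 1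
    descending-split = begin
      map inject₁ (reverse ((zero ∷ suc zero ∷ []) ++ tabulate Y))
        ≡⟨ cong (map inject₁) (Listₚ.reverse-++ (zero ∷ suc zero ∷ []) (tabulate Y)) ⟩
      map inject₁ (reverse (tabulate Y) ++ suc zero ∷ zero ∷ [])
        ≡⟨ Listₚ.map-++ inject₁ (reverse (tabulate Y)) _ ⟩
      map inject₁ (reverse (tabulate Y)) ++ v2 ∷ v1 ∷ []
        ≡⟨ cong (_++ v2 ∷ v1 ∷ []) (trans (Listₚ.reverse-map inject₁ (tabulate Y)) (cong reverse (Listₚ.map-tabulate Y inject₁))) ⟩
      Ydesc ++ v2 ∷ v1 ∷ []
        ∎

    S₂-Ydesc : mutateSeq Ydesc S₂ ≐ S₃
    S₂-Ydesc i l = trans (mutateSeq-cong Ydesc S₂-unchanged i l) (proj₁ sinks i l)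

    S₂-descending : mutateSeq (descending (3 ℕ.+ p)) S₂ ≐ P
    S₂-descending i l = begin
      mutateSeq (descending (3 ℕ.+ p)) S₂ i l ≡⟨ cong (λ ds → mutateSeq ds S₂ i l) descending-split ⟩
      mutateSeq (Ydesc ++ alt21 1) S₂ i l     ≡⟨ cong (λ M → M i l) (mutateSeq-++ Ydesc (alt21 1) S₂) ⟩
      mutate21 (mutateSeq Ydesc S₂) i l       ≡⟨ mutateSeq-cong (alt21 1) S₂-Ydesc i l ⟩
      S₄ i l                                  ≡⟨ S₄≐P i l ⟩
      P i l                                   ∎

    returns : mutateSeq (cycleSeq p k) Q ≐ Q
    returns i l = begin
      mutateSeq (alt12 k ++ (descending (3 ℕ.+ p) ++ alt21 k)) S₁ i l
        ≡⟨ cong (λ M → M i l) (trans (mutateSeq-++ (alt12 k) _ S₁) (mutateSeq-++ (descending (3 ℕ.+ p)) (alt21 k) S₂)) ⟩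
      mutateSeq (alt21 k) (mutateSeq (descending (3 ℕ.+ p)) S₂) i l
        ≡⟨ mutateSeq-cong (alt21 k) S₂-descending i l ⟩
      mutateSeq (alt21 k) P i l
        ≡⟨ alt21-undoes-alt12 k Q i l ⟩
      Q i l ∎

    alt12-nonIsolated : ∀ i {M : Matrix (4 ℕ.+ p)} → Pivots a M → NonIsolatedSteps M (alt12 i)
    alt12-nonIsolated i {M} M-pivots = alternating-nonIsolated i M (proj₁ nonZero) (proj₂ nonZero)
      where nonZero = pivots-nonZero M-pivots

    alt21-nonIsolated : ∀ i {M : Matrix (4 ℕ.+ p)} → Pivots a M → NonIsolatedSteps M (alt21 i)
    alt21-nonIsolated i {M} M-pivots = alternating-nonIsolated i M (proj₂ nonZero) (proj₁ nonZero)
      where nonZero = pivots-nonZero M-pivots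

    nonIsolated : NonIsolatedSteps Q (cycleSeq p k)
    nonIsolated =
      (λ isolated → ℤₚ.<⇒≢ (≥2⇒pos (Q-last v1)) (sym (isolated v1))) ,
      nonIsolatedSteps-++ (alt12 k) _ (alt12-nonIsolated k S₁-pivots)
        (nonIsolatedSteps-++ (descending (3 ℕ.+ p)) (alt21 k) descending-ok
          (nonIsolatedSteps-cong (alt21 k) (λ i l → sym (S₂-descending i l)) (alt21-nonIsolated k (alt12-pivots 0≤a k Q-pivots))))
      where
      Ydesc-ok : NonIsolatedSteps S₂ Ydesc
      Ydesc-ok = nonIsolatedSteps-cong Ydesc (λ i l → sym (S₂-unchanged i l)) (proj₂ sinks)
      descending-ok : NonIsolatedSteps S₂ (descending (3 ℕ.+ p))
      descending-ok = subst (NonIsolatedSteps S₂) (sym descending-split)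
        (nonIsolatedSteps-++ Ydesc (alt21 1) Ydesc-ok
          (nonIsolatedSteps-cong (alt21 1) (λ i l → sym (S₂-Ydesc i l)) (alt21-nonIsolated 1 S₃-pivots)))

    cyclicallyDistinct : CyclicallyDistinct (cycleSeq p k)
    cyclicallyDistinct = linked⇒consecDistinct (subst (λ xs → Linked _≢_ (top ∷ xs)) (sym shape) linked)
      where
      A = alt12 k
      B = alt21 k
      shape : (A ++ (descending (3 ℕ.+ p) ++ B)) ++ top ∷ [] ≡ A ++ (Ydesc ++ v2 ∷ v1 ∷ B ++ top ∷ [])
      shape = begin
        (A ++ (descending (3 ℕ.+ p) ++ B)) ++ top ∷ []   ≡⟨ Listₚ.++-assoc A _ _ ⟩
        A ++ ((descending (3 ℕ.+ p) ++ B) ++ top ∷ [])   ≡⟨ cong (A ++_) (Listₚ.++-assoc (descending (3 ℕ.+ p)) B _) ⟩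
        A ++ (descending (3 ℕ.+ p) ++ B ++ top ∷ [])     ≡⟨ cong (λ ds → A ++ (ds ++ B ++ top ∷ [])) descending-split ⟩
        A ++ ((Ydesc ++ v2 ∷ v1 ∷ []) ++ B ++ top ∷ [])  ≡⟨ cong (A ++_) (Listₚ.++-assoc Ydesc (v2 ∷ v1 ∷ []) _) ⟩
        A ++ (Ydesc ++ v2 ∷ v1 ∷ B ++ top ∷ [])          ∎
      X-injective : ∀ {y w} → X y ≡ X w → y ≡ w
      X-injective = Finₚ.suc-injective ∘ Finₚ.suc-injective ∘ Finₚ.inject₁-injective
      linked : Linked _≢_ (top ∷ A ++ (Ydesc ++ v2 ∷ v1 ∷ B ++ top ∷ []))
      linked = alternating-linked j (λ ()) (λ ()) (λ ())
                 (descending-linked p X X-injective (λ ())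
                   ((λ ()) ∷ (λ ()) ∷ alternating-linked j (λ ()) (λ ()) (λ ()) ((λ ()) ∷ [-])))

  mutationCycle : MutationCycle Q (cycleSeq p (suc j))
  mutationCycle = record { cyclicallyDistinct = cyclicallyDistinct ; nonIsolated = nonIsolated ; returns = returns }

≥2⇒2+ : ∀ {x} → x ℤ.≥ + 2 → Σ ℕ (λ e → x ≡ + 2 + + e)
≥2⇒2+ (+≤+ (s≤s (s≤s {n = e} _))) = e , refl

theorem4p1 : (p k : ℕ) → k ℕ.> 0 →
    (R : Matrix (3 ℕ.+ p)) → IsQuiver R →
    (∀ (i j : Fin (3 ℕ.+ p)) → i Fin.< j → R i j ℤ.≥ + 2) →
    (Q : Matrix (4 ℕ.+ p)) → IsQuiver Q →
    (∀ (i j : Fin (3 ℕ.+ p)) → Q (inject₁ i) (inject₁ j) ≡ mutateSeq (alt21 k) R i j) →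
    (∀ (i : Fin (3 ℕ.+ p)) → Q (inject₁ i) (fromℕ (3 ℕ.+ p)) ℤ.≥ + 2) →
    MutationCycle Q (cycleSeq p k)
theorem4p1 p (suc j) _ R R-quiver R-upper Q Q-quiver Q-block Q-last =
  Cycle.mutationCycle p j R R-quiver R-upper (proj₁ b₁₂) (proj₂ b₁₂) Q Q-quiver Q-block Q-last
  where
  b₁₂ = ≥2⇒2+ (R-upper v1 v2 (s≤s z≤n))
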